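{- Fix a logic $\mathcal{L}$. Let $\mathscr{E}$ be the class of morphisms $\epsilon$ in $\mathbf{FA}_{\mathcal{L}}$ such that $\epsilon^o$ is bijective on objects and full and every component of $\epsilon^p$ is surjective, and let $\mathscr{M}$ be the class of subprop-morphisms in $\mathbf{FA}_{\mathcal{L}}$. Let $F:(\mathcal{C},P)\to(\mathcal{D},Q)$ be a morphism in $\mathbf{FA}_{\mathcal{L}}$. Then: (1) $F=\psi\circ\epsilon$ for some $\epsilon\in\mathscr{E}$ and $\psi\in\mathscr{M}$. (2) If $K:(\mathcal{C},P)\to(\mathcal{E},R)$ is a morphism in $\mathbf{FA}_{\mathcal{L}}$ such that $K^o$ is full and surjective on objects and $K^p_c$ is surjective for each $c\in\mathrm{Ob}(\mathcal{C})$, then there exists a unique morphism $H:(\mathcal{E},R)\to(\mathcal{D},Q)$ with $H\circ K=F$ if and only if $\ker K\le\ker F$.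
   Context: Syntax and logics: a first-order language $\mathscr{L}$ has quantifier symbols $\mathscr{L}_q$ and connectives $\mathscr{L}_\omega$ with arities (designated $e\in\mathscr{L}_0$, $\otimes\in\mathscr{L}_2$); signatures with sorts, function and relation symbols; terms- and formulas-in-context; assertions are equations-in-context and sequents-in-context; theories are sets of assertions. A logic $\mathcal{L}$ assigns to each signature a closure operator $T\mapsto T_{\mathcal{L}}$ on theories (satisfying typed equational logic); $T\vdash_{\mathcal{L}}T'$ iff $A(T')\subseteq A(T_{\mathcal{L}})$. $\mathrm{Ob}(\mathbf{FA})$: prop-categories $(\mathcal{C},P)$ ($\mathcal{C}$ with designated finite products, $P:\mathcal{C}^{op}\to\mathbf{Pos}$) with $\mathscr{L}_\omega$-algebra structures on each $P(c)$ preserved by $P(f)$, elements $Eq_c\in P(c\times c)$, maps $\Omega_{b,c}:P(b\times c)\to P(b)$ natural in $b$, such that $(P(c),\otimes,e_c)$ is a monoid, $\Omega_{b,1}\circ P(\pi_1^{b,1})=\mathrm{id}$, $\Omega_{b,c\times d}\circ P(a_{b,c,d})=\Omega_{b,c}\circ\Omega_{b\times c,d}$, $Eq_1=e_{1\times1}$, $Eq_{c_1\times c_2}=P(\langle\pi_1^{c_1,c_2}\pi_1,\pi_1^{c_1,c_2}\pi_2\rangle)(Eq_{c_1})\otimes P(\langle\pi_2^{c_1,c_2}\pi_1,\pi_2^{c_1,c_2}\pi_2\rangle)(Eq_{c_2})$. Structures in $(\mathcal{C},P)$ interpret terms as morphisms and formulas as elements of $P$ in the standard way; a structure satisfies an equation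 if both sides agree and a sequent $\phi_1..\phi_n\vdash\phi$ if $\bigotimes[\![\phi_i]\!]\le[\![\phi]\!]$; $T\models_{(\mathcal{C},P)}T'$ iff every $T$-model in $(\mathcal{C},P)$ satisfies $T'$. $\mathrm{Ob}(\mathbf{FA}_{\mathcal{L}})$ is the class of $(\mathcal{C},P)\in\mathrm{Ob}(\mathbf{FA})$ such that $T\vdash_{\mathcal{L}}T'$ implies $T\models_{(\mathcal{C},P)}T'$; $\mathbf{FA}_{\mathcal{L}}$ is the full sub-2-category of $\mathbf{FA}$ on these objects. Morphisms $F:(\mathcal{C},P)\to(\mathcal{D},Q)$: finite-product-preserving $F^o$ and natural $F^p:P\Rightarrow QF^o$ with each $F^p_c$ an $\mathscr{L}_\omega$-homomorphism, $F^p_b\Omega_{b,c}=\Omega_{F^ob,F^oc}Q(a_{F,b,c}^{ -1})F^p_{b\times c}$, $F^p_{c\times c}(Eq_c)=Q(a_{F,c,c})Eq_{F^oc}$ ($a_{F,b,c}$ canonical iso). Composition $(K\circ F)^o=K^oF^o$, $(K\circ F)^p_c=K^p_{F^oc}F^p_c$. A subprop-morphism is a morphism $\iota$ with $\iota^o$ faithful and every $\iota^p$-component an order embedding. Kernel: $\ker F$ consists of the relation on $\mathrm{Ob}(\mathcal{C})$: $c_1\sim c_2$ iff $F^oc_1=F^oc_2$; the relation on morphisms: $f_1\sim f_2$ iff $F^of_1=F^of_2$; and the relation on $\bigsqcup_cP(c)$: $r_1\prec r_2$ (with $r_i\in P(c_i)$) iff $F^p_{c_1}(r_1)\le F^p_{c_2}(r_2)$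 (in particular $F^oc_1=F^oc_2$). $\ker K\le\ker F$ means each relation of $\ker K$ is contained in the corresponding relation of $\ker F$. -}

module Defs where

open import Level using (Level; 0ℓ) renaming (suc to lsuc)
open import Data.Nat using (ℕ; zero; suc)
open import Data.Fin using (Fin; zero; suc)
open import Data.List using (List; []; _∷_; foldr; map)
open import Data.Product using (Σ; Σ-syntax; _×_; _,_; proj₁; proj₂)
open import Relation.Binary.Core using (Rel)
open import Relation.Binary.Structures using (IsEquivalence; IsPartialOrder)
open import Relation.Binary.PropositionalEquality using (_≡_; refl; subst; subst₂)

record Language : Set₁ where
  field
    Quant : Set
    Conn  : ℕ → Set
    e⁰    : Conn 0
    ⊗²    : Conn 2

infixl 5 _▸_
data Ctx (S : Set) : Set where
  ∅   : Ctx S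
  _▸_ : Ctx S → S → Ctx S

infix 4 _∋_
data _∋_ {S : Set} : Ctx S → S → Set where
  here  : ∀ {Γ s} → (Γ ▸ s) ∋ s
  there : ∀ {Γ s t} → Γ ∋ s → (Γ ▸ t) ∋ s

record Signature : Set₁ where
  field
    Sort : Set
    FunSym  : Ctx Sort → Sort → Set
    RelSym : Ctx Sort → Set

module Syntax (𝕃 : Language) (Sg : Signature) where
  open Language 𝕃
  open Signature Sg

  data Term (Γ : Ctx Sort) : Sort → Set
  data Args (Γ : Ctx Sort) : Ctx Sort → Set

  data Term Γ where
    var : ∀ {s} → Γ ∋ s → Term Γ s
    app : ∀ {Δ s} → FunSym Δ s → Args Γ Δ → Term Γ s

  data Args Γ where
    ∅   : Args Γ ∅
    _,_ : ∀ {Δ s} → Args Γ Δ → Term Γ s → Args Γ (Δ ▸ s)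

  Sub : Ctx Sort → Ctx Sort → Set
  Sub Δ Γ = ∀ {s} → Γ ∋ s → Term Δ s

  subT : ∀ {Γ Δ s} → Sub Δ Γ → Term Γ s → Term Δ s
  subA : ∀ {Γ Δ Θ} → Sub Δ Γ → Args Γ Θ → Args Δ Θ
  subT σ (var x)    = σ x
  subT σ (app f ts) = app f (subA σ ts)
  subA σ ∅          = ∅
  subA σ (ts , t)   = subA σ ts , subT σ t

  data Formula : Ctx Sort → Set where
    rel   : ∀ {Γ Δ} → RelSym Δ → Args Γ Δ → Formula Γ
    _≐_   : ∀ {Γ s} → Term Γ s → Term Γ s → Formula Γ
    conn  : ∀ {Γ n} → Conn n → (Fin n → Formula Γ) → Formula Γ
    quant : ∀ {Γ} → Quant → (s : Sort) → Formula (Γ ▸ s) → Formula Γ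

  data Assertion : Set where
    eqn : (Γ : Ctx Sort) {s : Sort} → Term Γ s → Term Γ s → Assertion
    seq : (Γ : Ctx Sort) → List (Formula Γ) → Formula Γ → Assertion

  Theory : Set₁
  Theory = Assertion → Set

  _⊆_ : Theory → Theory → Set
  T ⊆ T' = ∀ a → T a → T' a

  data EqDeriv (T : Theory) : (Γ : Ctx Sort) {s : Sort} → Term Γ s → Term Γ s → Set where
    ax    : ∀ {Γ Δ s} {t u : Term Γ s} → T (eqn Γ t u) → (σ : Sub Δ Γ) →
            EqDeriv T Δ (subT σ t) (subT σ u)
    refl' : ∀ {Γ s} (t : Term Γ s) → EqDeriv T Γ t t
    sym'  : ∀ {Γ s} {t u : Term Γ s} → EqDeriv T Γ t u → EqDeriv T Γ u t
    trans' : ∀ {Γ s} {t u v : Term Γ s} → EqDeriv T Γ t u → EqDeriv T Γ u v →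
             EqDeriv T Γ t v
    cong' : ∀ {Γ Δ s} (t : Term Γ s) (σ τ : Sub Δ Γ) →
            (∀ {s'} (x : Γ ∋ s') → EqDeriv T Δ (σ x) (τ x)) →
            EqDeriv T Δ (subT σ t) (subT τ t)

record Logic (𝕃 : Language) : Set₁ where
  open Syntax 𝕃
  field
    closure   : (Sg : Signature) → Theory Sg → Theory Sg
    extensive : ∀ Sg T → _⊆_ Sg T (closure Sg T)
    monotone  : ∀ Sg T T' → _⊆_ Sg T T' → _⊆_ Sg (closure Sg T) (closure Sg T')
    idempotent : ∀ Sg T → _⊆_ Sg (closure Sg (closure Sg T)) (closure Sg T)
    equational : ∀ Sg T Γ {s} (t u : Term Sg Γ s) →
                 EqDeriv Sg (closure Sg T) Γ t u → closure Sg T (eqn Γ t u)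

  _⊢_ : ∀ {Sg} → Theory Sg → Theory Sg → Set
  _⊢_ {Sg} T T' = _⊆_ Sg T' (closure Sg T)

record FPCat : Set₁ where
  infixr 9 _∘_
  infix 4 _≈_
  infixr 7 _⊗ₒ_
  field
    Obj : Set
    Hom : Obj → Obj → Set
    _≈_ : ∀ {a b} → Rel (Hom a b) 0ℓ
    ≈-equiv : ∀ {a b} → IsEquivalence (_≈_ {a} {b})
    id  : ∀ {a} → Hom a a
    _∘_ : ∀ {a b c} → Hom b c → Hom a b → Hom a c
    ∘-cong : ∀ {a b c} {f f' : Hom b c} {g g' : Hom a b} →
             f ≈ f' → g ≈ g' → f ∘ g ≈ f' ∘ g'
    identityˡ : ∀ {a b} (f : Hom a b) → id ∘ f ≈ f
    identityʳ : ∀ {a b} (f : Hom a b) → f ∘ id ≈ f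
    assoc : ∀ {a b c d} (f : Hom c d) (g : Hom b c) (h : Hom a b) →
            (f ∘ g) ∘ h ≈ f ∘ (g ∘ h)
    𝟙 : Obj
    ! : ∀ {a} → Hom a 𝟙
    !-unique : ∀ {a} (f : Hom a 𝟙) → f ≈ !
    _⊗ₒ_ : Obj → Obj → Obj
    π₁ : ∀ {a b} → Hom (a ⊗ₒ b) a
    π₂ : ∀ {a b} → Hom (a ⊗ₒ b) b
    ⟨_,_⟩ : ∀ {a b c} → Hom c a → Hom c b → Hom c (a ⊗ₒ b)
    π₁-β : ∀ {a b c} (f : Hom c a) (g : Hom c b) → π₁ ∘ ⟨ f , g ⟩ ≈ f
    π₂-β : ∀ {a b c} (f : Hom c a) (g : Hom c b) → π₂ ∘ ⟨ f , g ⟩ ≈ g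
    ⟨⟩-unique : ∀ {a b c} {f : Hom c a} {g : Hom c b} (h : Hom c (a ⊗ₒ b)) →
                π₁ ∘ h ≈ f → π₂ ∘ h ≈ g → h ≈ ⟨ f , g ⟩

  _⊗ₘ_ : ∀ {a b c d} → Hom a b → Hom c d → Hom (a ⊗ₒ c) (b ⊗ₒ d)
  f ⊗ₘ g = ⟨ f ∘ π₁ , g ∘ π₂ ⟩

  αₘ : ∀ {b c d} → Hom (b ⊗ₒ (c ⊗ₒ d)) ((b ⊗ₒ c) ⊗ₒ d)
  αₘ = ⟨ ⟨ π₁ , π₁ ∘ π₂ ⟩ , π₂ ∘ π₂ ⟩

  HomEq : ∀ {a b a' b'} → Hom a b → Hom a' b' → Set
  HomEq {a} {b} {a'} {b'} f g =
    Σ (a ≡ a') λ p → Σ (b ≡ b') λ q → subst₂ Hom p q f ≈ g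

record FAObj (𝕃 : Language) : Set₁ where
  open Language 𝕃
  field
    cat : FPCat
  open FPCat cat public
  infix 4 _≈ᴾ_ _≤ᴾ_
  field
    P    : Obj → Set
    _≈ᴾ_ : ∀ {c} → Rel (P c) 0ℓ
    _≤ᴾ_ : ∀ {c} → Rel (P c) 0ℓ
    isPO : ∀ {c} → IsPartialOrder (_≈ᴾ_ {c}) (_≤ᴾ_ {c})
    Pmap : ∀ {a b} → Hom a b → P b → P a
    Pmap-mono : ∀ {a b} (f : Hom a b) {r s : P b} → r ≤ᴾ s → Pmap f r ≤ᴾ Pmap f s
    Pmap-cong : ∀ {a b} {f g : Hom a b} → f ≈ g → (r : P b) → Pmap f r ≈ᴾ Pmap g r
    Pmap-id : ∀ {c} (r : P c) → Pmap id r ≈ᴾ r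
    Pmap-∘ : ∀ {a b c} (f : Hom b c) (g : Hom a b) (r : P c) →
             Pmap (f ∘ g) r ≈ᴾ Pmap g (Pmap f r)
    op : ∀ {n} → Conn n → ∀ {c} → (Fin n → P c) → P c
    op-cong : ∀ {n} (σ : Conn n) {c} {rs ss : Fin n → P c} →
              (∀ i → rs i ≈ᴾ ss i) → op σ rs ≈ᴾ op σ ss
    op-nat : ∀ {n} (σ : Conn n) {a b} (f : Hom a b) (rs : Fin n → P b) →
             Pmap f (op σ rs) ≈ᴾ op σ (λ i → Pmap f (rs i))

  eᴾ : ∀ {c} → P c
  eᴾ = op e⁰ (λ ())

  infixr 6 _⊗ᴾ_
  _⊗ᴾ_ : ∀ {c} → P c → P c → P c
  r ⊗ᴾ s = op ⊗² (λ { zero → r ; (suc zero) → s })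

  field
    Eq : ∀ c → P (c ⊗ₒ c)
    Ω  : Quant → ∀ b c → P (b ⊗ₒ c) → P b
    Ω-cong : ∀ q b c {r s : P (b ⊗ₒ c)} → r ≈ᴾ s → Ω q b c r ≈ᴾ Ω q b c s
    Ω-nat : ∀ q {a b} c (f : Hom a b) (r : P (b ⊗ₒ c)) →
            Ω q a c (Pmap (f ⊗ₘ id) r) ≈ᴾ Pmap f (Ω q b c r)
    ⊗-assoc : ∀ {c} (r s t : P c) → (r ⊗ᴾ s) ⊗ᴾ t ≈ᴾ r ⊗ᴾ (s ⊗ᴾ t)
    ⊗-identityˡ : ∀ {c} (r : P c) → eᴾ ⊗ᴾ r ≈ᴾ r
    ⊗-identityʳ : ∀ {c} (r : P c) → r ⊗ᴾ eᴾ ≈ᴾ r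
    Ω-unit : ∀ q b (r : P b) → Ω q b 𝟙 (Pmap π₁ r) ≈ᴾ r
    Ω-assoc : ∀ q b c d (r : P ((b ⊗ₒ c) ⊗ₒ d)) →
              Ω q b (c ⊗ₒ d) (Pmap αₘ r) ≈ᴾ Ω q b c (Ω q (b ⊗ₒ c) d r)
    Eq-𝟙 : Eq 𝟙 ≈ᴾ eᴾ
    Eq-⊗ : ∀ c₁ c₂ → Eq (c₁ ⊗ₒ c₂) ≈ᴾ
             Pmap ⟨ π₁ ∘ π₁ , π₁ ∘ π₂ ⟩ (Eq c₁) ⊗ᴾ Pmap ⟨ π₂ ∘ π₁ , π₂ ∘ π₂ ⟩ (Eq c₂)

  PEq : ∀ {c c'} → P c → P c' → Set
  PEq {c} {c'} r r' = Σ (c ≡ c') λ p → subst P p r ≈ᴾ r'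

  PLe : ∀ {c c'} → P c → P c' → Set
  PLe {c} {c'} r r' = Σ (c ≡ c') λ p → subst P p r ≤ᴾ r'

module Semantics {𝕃 : Language} (X : FAObj 𝕃) (Sg : Signature) where
  open Language 𝕃
  open Signature Sg
  open FAObj X
  open Syntax 𝕃 Sg

  ctxObj : (Sort → Obj) → Ctx Sort → Obj
  ctxObj I ∅       = 𝟙
  ctxObj I (Γ ▸ s) = ctxObj I Γ ⊗ₒ I s

  record Structure : Set where
    field
      ⟦_⟧ˢ : Sort → Obj
    ⟦_⟧ᶜ : Ctx Sort → Obj
    ⟦_⟧ᶜ = ctxObj ⟦_⟧ˢ
    field
      ⟦_⟧ᶠ : ∀ {Δ s} → FunSym Δ s → Hom ⟦ Δ ⟧ᶜ ⟦ s ⟧ˢ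
      ⟦_⟧ʳ : ∀ {Δ} → RelSym Δ → P ⟦ Δ ⟧ᶜ

    ⟦_⟧ᵛ : ∀ {Γ s} → Γ ∋ s → Hom ⟦ Γ ⟧ᶜ ⟦ s ⟧ˢ
    ⟦ here ⟧ᵛ    = π₂
    ⟦ there x ⟧ᵛ = ⟦ x ⟧ᵛ ∘ π₁

    ⟦_⟧ᵗ : ∀ {Γ s} → Term Γ s → Hom ⟦ Γ ⟧ᶜ ⟦ s ⟧ˢ
    ⟦_⟧ᵃ : ∀ {Γ Δ} → Args Γ Δ → Hom ⟦ Γ ⟧ᶜ ⟦ Δ ⟧ᶜ
    ⟦ var x ⟧ᵗ    = ⟦ x ⟧ᵛ
    ⟦ app f ts ⟧ᵗ = ⟦ f ⟧ᶠ ∘ ⟦ ts ⟧ᵃ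
    ⟦ ∅ ⟧ᵃ        = !
    ⟦ ts , t ⟧ᵃ   = ⟨ ⟦ ts ⟧ᵃ , ⟦ t ⟧ᵗ ⟩

    ⟦_⟧ᵩ : ∀ {Γ} → Formula Γ → P ⟦ Γ ⟧ᶜ
    ⟦ rel R ts ⟧ᵩ     = Pmap ⟦ ts ⟧ᵃ ⟦ R ⟧ʳ
    ⟦ t ≐ u ⟧ᵩ        = Pmap ⟨ ⟦ t ⟧ᵗ , ⟦ u ⟧ᵗ ⟩ (Eq _)
    ⟦ conn σ φs ⟧ᵩ    = op σ (λ i → ⟦ φs i ⟧ᵩ)
    ⟦ quant q s φ ⟧ᵩ  = Ω q _ ⟦ s ⟧ˢ ⟦ φ ⟧ᵩ

    ⟦_⟧ᴸ : ∀ {Γ} → List (Formula Γ) → P ⟦ Γ ⟧ᶜ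
    ⟦ [] ⟧ᴸ     = eᴾ
    ⟦ φ ∷ φs ⟧ᴸ = ⟦ φ ⟧ᵩ ⊗ᴾ ⟦ φs ⟧ᴸ

    Satisfies : Assertion → Set
    Satisfies (eqn Γ t u)  = ⟦ t ⟧ᵗ ≈ ⟦ u ⟧ᵗ
    Satisfies (seq Γ φs φ) = ⟦ φs ⟧ᴸ ≤ᴾ ⟦ φ ⟧ᵩ

    IsModel : Theory → Set
    IsModel T = ∀ a → T a → Satisfies a

  _⊨_ : Theory → Theory → Set
  T ⊨ T' = (M : Structure) → Structure.IsModel M T → Structure.IsModel M T'

IsFAL : {𝕃 : Language} → Logic 𝕃 → FAObj 𝕃 → Set₁
IsFAL {𝕃} L X = (Sg : Signature) (T T' : Syntax.Theory 𝕃 Sg) →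
                Logic._⊢_ L {Sg} T T' → Semantics._⊨_ X Sg T T'

record FALObj {𝕃 : Language} (L : Logic 𝕃) : Set₁ where
  field
    obj  : FAObj 𝕃
    isFAL : IsFAL L obj

open FALObj public

record Mor {𝕃 : Language} (X Y : FAObj 𝕃) : Set where
  private
    module X = FAObj X
    module Y = FAObj Y
  field
    Fo : X.Obj → Y.Obj
    Fm : ∀ {a b} → X.Hom a b → Y.Hom (Fo a) (Fo b)
    Fm-cong : ∀ {a b} {f g : X.Hom a b} → f X.≈ g → Fm f Y.≈ Fm g
    Fm-id : ∀ {a} → Fm (X.id {a}) Y.≈ Y.id
    Fm-∘ : ∀ {a b c} (f : X.Hom b c) (g : X.Hom a b) → Fm (f X.∘ g) Y.≈ Fm f Y.∘ Fm g
    𝟙-inv  : Y.Hom Y.𝟙 (Fo X.𝟙)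
    𝟙-invˡ : 𝟙-inv Y.∘ Y.! Y.≈ Y.id
    𝟙-invʳ : Y.! Y.∘ 𝟙-inv Y.≈ Y.id

  aF : ∀ {b c} → Y.Hom (Fo (b X.⊗ₒ c)) (Fo b Y.⊗ₒ Fo c)
  aF = Y.⟨ Fm X.π₁ , Fm X.π₂ ⟩

  field
    aF⁻¹ : ∀ {b c} → Y.Hom (Fo b Y.⊗ₒ Fo c) (Fo (b X.⊗ₒ c))
    aF-invˡ : ∀ {b c} → aF⁻¹ {b} {c} Y.∘ aF Y.≈ Y.id
    aF-invʳ : ∀ {b c} → aF {b} {c} Y.∘ aF⁻¹ Y.≈ Y.id
    Fp : ∀ {c} → X.P c → Y.P (Fo c)
    Fp-mono : ∀ {c} {r s : X.P c} → r X.≤ᴾ s → Fp r Y.≤ᴾ Fp s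
    Fp-nat : ∀ {a b} (f : X.Hom a b) (r : X.P b) →
             Fp (X.Pmap f r) Y.≈ᴾ Y.Pmap (Fm f) (Fp r)
    Fp-hom : ∀ {n} (σ : Language.Conn 𝕃 n) {c} (rs : Fin n → X.P c) →
             Fp (X.op σ rs) Y.≈ᴾ Y.op σ (λ i → Fp (rs i))
    Fp-Ω : ∀ q b c (r : X.P (b X.⊗ₒ c)) →
           Fp (X.Ω q b c r) Y.≈ᴾ Y.Ω q (Fo b) (Fo c) (Y.Pmap aF⁻¹ (Fp r))
    Fp-Eq : ∀ c → Fp (X.Eq c) Y.≈ᴾ Y.Pmap aF (Y.Eq (Fo c))

module _ {𝕃 : Language} {X Y Z : FAObj 𝕃} where
  private
    module X = FAObj X
    module Y = FAObj Y
    module Z = FAObj Z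
  open Mor

  CompEq : Mor Y Z → Mor X Y → Mor X Z → Set
  CompEq H K F =
    (∀ c → Fo H (Fo K c) ≡ Fo F c) ×
    (∀ {a b} (f : X.Hom a b) → Z.HomEq (Fm H (Fm K f)) (Fm F f)) ×
    (∀ {c} (r : X.P c) → Z.PEq (Fp H (Fp K r)) (Fp F r))

module _ {𝕃 : Language} {X Y : FAObj 𝕃} where
  private
    module X = FAObj X
    module Y = FAObj Y
  open Mor

  MorEq : Mor X Y → Mor X Y → Set
  MorEq G H =
    (∀ c → Fo G c ≡ Fo H c) ×
    (∀ {a b} (f : X.Hom a b) → Y.HomEq (Fm G f) (Fm H f)) ×
    (∀ {c} (r : X.P c) → Y.PEq (Fp G r) (Fp H r))

  InE : Mor X Y → Set
  InE ε =
    (∀ a b → Fo ε a ≡ Fo ε b → a ≡ b) ×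
    (∀ d → Σ X.Obj λ c → Fo ε c ≡ d) ×
    (∀ {a b} (g : Y.Hom (Fo ε a) (Fo ε b)) → Σ (X.Hom a b) λ f → Fm ε f Y.≈ g) ×
    (∀ {c} (q : Y.P (Fo ε c)) → Σ (X.P c) λ r → Fp ε r Y.≈ᴾ q)

  InM : Mor X Y → Set
  InM ι =
    (∀ {a b} {f g : X.Hom a b} → Fm ι f Y.≈ Fm ι g → f X.≈ g) ×
    (∀ {c} {r s : X.P c} → Fp ι r Y.≤ᴾ Fp ι s → r X.≤ᴾ s)

  FullSurj : Mor X Y → Set
  FullSurj K =
    (∀ {a b} (g : Y.Hom (Fo K a) (Fo K b)) → Σ (X.Hom a b) λ f → Fm K f Y.≈ g) ×
    (∀ d → Σ X.Obj λ c → Fo K c ≡ d) ×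
    (∀ {c} (q : Y.P (Fo K c)) → Σ (X.P c) λ r → Fp K r Y.≈ᴾ q)

module _ {𝕃 : Language} {X Y Z : FAObj 𝕃} where
  private
    module X = FAObj X
    module Y = FAObj Y
    module Z = FAObj Z
  open Mor

  KerLe : Mor X Z → Mor X Y → Set
  KerLe K F =
    (∀ c₁ c₂ → Fo K c₁ ≡ Fo K c₂ → Fo F c₁ ≡ Fo F c₂) ×
    (∀ {a₁ b₁ a₂ b₂} (f₁ : X.Hom a₁ b₁) (f₂ : X.Hom a₂ b₂) →
       Z.HomEq (Fm K f₁) (Fm K f₂) → Y.HomEq (Fm F f₁) (Fm F f₂)) ×
    (∀ {c₁ c₂} (r₁ : X.P c₁) (r₂ : X.P c₂) →
       Z.PLe (Fp K r₁) (Fp K r₂) → Y.PLe (Fp F r₁) (Fp F r₂))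

{-# OPTIONS --safe #-}
-- (1) F factors through its image: the objects, morphisms and predicates of X, with morphisms
-- identified and predicates ordered exactly when their F-images are. Then ε is the identity on
-- data and ψ acts as F, so ε ∈ 𝓔 and ψ ∈ 𝓜 by construction. The image lies in FA_𝓛 because a
-- structure in it pushes forward along ψ to a structure in Y (through the canonical isomorphisms
-- F⟦Γ⟧ ≅ ⟦Γ⟧), and ψ, being faithful and order-reflecting, reflects satisfaction back; soundness
-- for 𝓛 is thus inherited from Y.
--
-- (2) Any H with H ∘ K = F carries equalities and inequalities between K-images to ones between
-- F-images, i.e. ker K ≤ ker F. Conversely, as K is full and surjective, every object, morphism and
-- predicate of Z is a K-image up to the transport θ_d : K(ob d) ≅ d, and H is F applied to a chosen
-- preimage. Every law of H becomes an equation in X that holds after K, hence after F by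
-- ker K ≤ ker F; uniqueness holds because H' ∘ K = F fixes H' on all K-images.
module Submission where

open import Defs
open import Level using (0ℓ)
open import Data.Fin using (Fin; zero; suc)
open import Data.List using (List; []; _∷_)
open import Data.Product using (Σ; _×_; _,_; proj₁; proj₂)
open import Function using (_∘′_)
open import Relation.Binary.Bundles using (Setoid)
open import Relation.Binary.Structures using (IsEquivalence; IsPartialOrder)
open import Relation.Binary.PropositionalEquality as ≡ using (_≡_; refl)
import Relation.Binary.Reasoning.Setoid as SetoidReasoning

module FPCatProperties (C : FPCat) where
  open FPCat C

  module ≈ {a b} = IsEquivalence (≈-equiv {a} {b})

  hom-setoid : Obj → Obj → Setoid 0ℓ 0ℓ
  hom-setoid a b = record { isEquivalence = ≈-equiv {a} {b} }

  module HomReasoning {a b} = SetoidReasoning (hom-setoid a b)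
  open HomReasoning

  ∘-congˡ : ∀ {a b c} {f : Hom b c} {g g' : Hom a b} → g ≈ g' → f ∘ g ≈ f ∘ g'
  ∘-congˡ = ∘-cong ≈.refl

  ∘-congʳ : ∀ {a b c} {f f' : Hom b c} {g : Hom a b} → f ≈ f' → f ∘ g ≈ f' ∘ g
  ∘-congʳ p = ∘-cong p ≈.refl

  sym-assoc : ∀ {a b c d} (f : Hom c d) (g : Hom b c) (h : Hom a b) →
              f ∘ (g ∘ h) ≈ (f ∘ g) ∘ h
  sym-assoc f g h = ≈.sym (assoc f g h)

  cancelˡ : ∀ {a b c} {u : Hom b c} {v : Hom c b} (h : Hom a c) →
            u ∘ v ≈ id → u ∘ (v ∘ h) ≈ h
  cancelˡ {u = u} {v} h uv = begin
    u ∘ (v ∘ h) ≈⟨ sym-assoc u v h ⟩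
    (u ∘ v) ∘ h ≈⟨ ∘-congʳ uv ⟩
    id ∘ h      ≈⟨ identityˡ h ⟩
    h           ∎

  cancelʳ : ∀ {a b c} {u : Hom b a} {v : Hom a b} (h : Hom a c) →
            u ∘ v ≈ id → (h ∘ u) ∘ v ≈ h
  cancelʳ {u = u} {v} h uv = begin
    (h ∘ u) ∘ v ≈⟨ assoc h u v ⟩
    h ∘ (u ∘ v) ≈⟨ ∘-congˡ uv ⟩
    h ∘ id      ≈⟨ identityʳ h ⟩
    h           ∎

  cancelInner : ∀ {a b c d} {u : Hom b c} {v : Hom c b} (f : Hom c d) (h : Hom a c) →
                u ∘ v ≈ id → (f ∘ u) ∘ (v ∘ h) ≈ f ∘ h
  cancelInner {u = u} {v} f h uv = begin
    (f ∘ u) ∘ (v ∘ h) ≈⟨ assoc f u (v ∘ h) ⟩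
    f ∘ (u ∘ (v ∘ h)) ≈⟨ ∘-congˡ (cancelˡ h uv) ⟩
    f ∘ h             ∎

  section⇒epic : ∀ {a b c} {u : Hom a b} {v : Hom b a} {f g : Hom b c} →
                 u ∘ v ≈ id → f ∘ u ≈ g ∘ u → f ≈ g
  section⇒epic {u = u} {v} {f} {g} uv fu≈gu = begin
    f           ≈⟨ cancelʳ f uv ⟨
    (f ∘ u) ∘ v ≈⟨ ∘-congʳ fu≈gu ⟩
    (g ∘ u) ∘ v ≈⟨ cancelʳ g uv ⟩
    g           ∎

  retraction⇒monic : ∀ {a b c} {u : Hom b c} {v : Hom c b} {f g : Hom a b} →
                     v ∘ u ≈ id → u ∘ f ≈ u ∘ g → f ≈ g
  retraction⇒monic {u = u} {v} {f} {g} vu uf≈ug = begin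
    f           ≈⟨ cancelˡ f vu ⟨
    v ∘ (u ∘ f) ≈⟨ ∘-congˡ uf≈ug ⟩
    v ∘ (u ∘ g) ≈⟨ cancelˡ g vu ⟩
    g           ∎

  !-unique₂ : ∀ {a} (f g : Hom a 𝟙) → f ≈ g
  !-unique₂ f g = ≈.trans (!-unique f) (≈.sym (!-unique g))

  ⟨⟩-cong : ∀ {a b c} {f f' : Hom c a} {g g' : Hom c b} → f ≈ f' → g ≈ g' →
            ⟨ f , g ⟩ ≈ ⟨ f' , g' ⟩
  ⟨⟩-cong {f = f} {g = g} p q =
    ⟨⟩-unique ⟨ f , g ⟩ (≈.trans (π₁-β f g) p) (≈.trans (π₂-β f g) q)

  ⟨⟩∘ : ∀ {a b c d} (f : Hom c a) (g : Hom c b) (h : Hom d c) →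
        ⟨ f , g ⟩ ∘ h ≈ ⟨ f ∘ h , g ∘ h ⟩
  ⟨⟩∘ f g h = ⟨⟩-unique (⟨ f , g ⟩ ∘ h)
    (≈.trans (sym-assoc π₁ ⟨ f , g ⟩ h) (∘-congʳ (π₁-β f g)))
    (≈.trans (sym-assoc π₂ ⟨ f , g ⟩ h) (∘-congʳ (π₂-β f g)))

  ⟨π₁,π₂⟩≈id : ∀ {a b} → ⟨ π₁ , π₂ ⟩ ≈ id {a ⊗ₒ b}
  ⟨π₁,π₂⟩≈id = ≈.sym (⟨⟩-unique id (identityʳ π₁) (identityʳ π₂))

  ⊗ₘ∘⟨⟩ : ∀ {a b c d e} (f : Hom a b) (g : Hom c d) (h : Hom e a) (k : Hom e c) →
          (f ⊗ₘ g) ∘ ⟨ h , k ⟩ ≈ ⟨ f ∘ h , g ∘ k ⟩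
  ⊗ₘ∘⟨⟩ f g h k = begin
    ⟨ f ∘ π₁ , g ∘ π₂ ⟩ ∘ ⟨ h , k ⟩                   ≈⟨ ⟨⟩∘ (f ∘ π₁) (g ∘ π₂) ⟨ h , k ⟩ ⟩
    ⟨ (f ∘ π₁) ∘ ⟨ h , k ⟩ , (g ∘ π₂) ∘ ⟨ h , k ⟩ ⟩ ≈⟨ ⟨⟩-cong (≈.trans (assoc f π₁ _) (∘-congˡ (π₁-β h k)))
                                                              (≈.trans (assoc g π₂ _) (∘-congˡ (π₂-β h k))) ⟩
    ⟨ f ∘ h , g ∘ k ⟩                                 ∎

  ⊗ₘ∘⊗ₘ : ∀ {a b c d e e'} (f : Hom a b) (g : Hom c d) (h : Hom e a) (k : Hom e' c) →
          (f ⊗ₘ g) ∘ (h ⊗ₘ k) ≈ (f ∘ h) ⊗ₘ (g ∘ k)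
  ⊗ₘ∘⊗ₘ f g h k = ≈.trans (⊗ₘ∘⟨⟩ f g (h ∘ π₁) (k ∘ π₂))
    (⟨⟩-cong (sym-assoc f h π₁) (sym-assoc g k π₂))

  ⊗ₘ-cong : ∀ {a b c d} {f f' : Hom a b} {g g' : Hom c d} → f ≈ f' → g ≈ g' → f ⊗ₘ g ≈ f' ⊗ₘ g'
  ⊗ₘ-cong p q = ⟨⟩-cong (∘-congʳ p) (∘-congʳ q)

  id⊗ₘid : ∀ {a b} → id {a} ⊗ₘ id {b} ≈ id
  id⊗ₘid = ≈.trans (⟨⟩-cong (identityˡ π₁) (identityˡ π₂)) ⟨π₁,π₂⟩≈id

  ⊗ₘ-inverse : ∀ {a b c d} {u : Hom a b} {v : Hom b a} {u' : Hom c d} {v' : Hom d c} →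
               u ∘ v ≈ id → u' ∘ v' ≈ id → (u ⊗ₘ u') ∘ (v ⊗ₘ v') ≈ id
  ⊗ₘ-inverse uv uv' = ≈.trans (⊗ₘ∘⊗ₘ _ _ _ _) (≈.trans (⊗ₘ-cong uv uv') id⊗ₘid)

  π₁∘⊗ₘ : ∀ {a b c d} (f : Hom a b) (g : Hom c d) → π₁ ∘ (f ⊗ₘ g) ≈ f ∘ π₁
  π₁∘⊗ₘ f g = π₁-β (f ∘ π₁) (g ∘ π₂)

  π₂∘⊗ₘ : ∀ {a b c d} (f : Hom a b) (g : Hom c d) → π₂ ∘ (f ⊗ₘ g) ≈ g ∘ π₂
  π₂∘⊗ₘ f g = π₂-β (f ∘ π₁) (g ∘ π₂)

  ≡⇒Hom : ∀ {a b} → a ≡ b → Hom a b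
  ≡⇒Hom refl = id

  ≡⇒Hom-inverseʳ : ∀ {a b} (e : a ≡ b) → ≡⇒Hom e ∘ ≡⇒Hom (≡.sym e) ≈ id
  ≡⇒Hom-inverseʳ refl = identityˡ id

  ≡⇒Hom-inverseˡ : ∀ {a b} (e : a ≡ b) → ≡⇒Hom (≡.sym e) ∘ ≡⇒Hom e ≈ id
  ≡⇒Hom-inverseˡ refl = identityˡ id

  HomEq-sym : ∀ {a b a' b'} {f : Hom a b} {g : Hom a' b'} → HomEq f g → HomEq g f
  HomEq-sym (refl , refl , p) = refl , refl , ≈.sym p

  HomEq-trans : ∀ {a b a' b' a'' b''} {f : Hom a b} {g : Hom a' b'} {h : Hom a'' b''} →
                HomEq f g → HomEq g h → HomEq f h
  HomEq-trans (refl , refl , p) (refl , refl , q) = refl , refl , ≈.trans p q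

  HomEq⇒≈ : ∀ {a b} {f g : Hom a b} → HomEq f g → f ≈ g
  HomEq⇒≈ (refl , refl , p) = p

  ≈-conjugate⇒HomEq : ∀ {a b a' b'} (e : a ≡ a') (e' : b ≡ b') {f : Hom a b} {g : Hom a' b'} →
                      f ≈ ≡⇒Hom (≡.sym e') ∘ (g ∘ ≡⇒Hom e) → HomEq f g
  ≈-conjugate⇒HomEq refl refl {g = g} p =
    refl , refl , ≈.trans p (≈.trans (identityˡ _) (identityʳ g))

module PredicateProperties {𝕃 : Language} (X : FAObj 𝕃) where
  open FAObj X
  open Language 𝕃 using (⊗²; e⁰)
  private
    module CP = FPCatProperties cat

  module ≈ᴾ {c} = IsEquivalence (IsPartialOrder.isEquivalence (isPO {c}))
  module ≤ᴾ {c} = IsPartialOrder (isPO {c})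

  P-setoid : Obj → Setoid 0ℓ 0ℓ
  P-setoid c = record { isEquivalence = IsPartialOrder.isEquivalence (isPO {c}) }

  module PReasoning {c} = SetoidReasoning (P-setoid c)
  open PReasoning

  ≤ᴾ-resp-≈ᴾ : ∀ {c} {r r' s s' : P c} → r ≈ᴾ r' → s ≈ᴾ s' → r ≤ᴾ s → r' ≤ᴾ s'
  ≤ᴾ-resp-≈ᴾ p q r≤s = ≤ᴾ.trans (≤ᴾ.reflexive (≈ᴾ.sym p)) (≤ᴾ.trans r≤s (≤ᴾ.reflexive q))

  Pmap-resp-≈ᴾ : ∀ {a b} (f : Hom a b) {r s : P b} → r ≈ᴾ s → Pmap f r ≈ᴾ Pmap f s
  Pmap-resp-≈ᴾ f p = ≤ᴾ.antisym (Pmap-mono f (≤ᴾ.reflexive p)) (Pmap-mono f (≤ᴾ.reflexive (≈ᴾ.sym p)))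

  Pmap-inverse : ∀ {a b} {u : Hom a b} {v : Hom b a} → u ∘ v ≈ id → (r : P b) →
                 Pmap v (Pmap u r) ≈ᴾ r
  Pmap-inverse {u = u} {v} uv r = begin
    Pmap v (Pmap u r) ≈⟨ Pmap-∘ u v r ⟨
    Pmap (u ∘ v) r    ≈⟨ Pmap-cong uv r ⟩
    Pmap id r         ≈⟨ Pmap-id r ⟩
    r                 ∎

  op-⊗²-cong : ∀ {c} {h h' : Fin 2 → P c} → h zero ≈ᴾ h' zero → h (suc zero) ≈ᴾ h' (suc zero) →
               op ⊗² h ≈ᴾ op ⊗² h'
  op-⊗²-cong p q = op-cong ⊗² λ { zero → p ; (suc zero) → q }

  op-e⁰-cong : ∀ {c} {h h' : Fin 0 → P c} → op e⁰ h ≈ᴾ op e⁰ h'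
  op-e⁰-cong = op-cong e⁰ λ ()

  ⊗ᴾ-cong : ∀ {c} {r r' s s' : P c} → r ≈ᴾ r' → s ≈ᴾ s' → r ⊗ᴾ s ≈ᴾ r' ⊗ᴾ s'
  ⊗ᴾ-cong = op-⊗²-cong

  Pmap-eᴾ : ∀ {a b} (f : Hom a b) → Pmap f (eᴾ {b}) ≈ᴾ eᴾ
  Pmap-eᴾ f = ≈ᴾ.trans (op-nat e⁰ f (λ ())) op-e⁰-cong

  Pmap-⊗ᴾ : ∀ {a b} (f : Hom a b) (r s : P b) → Pmap f (r ⊗ᴾ s) ≈ᴾ Pmap f r ⊗ᴾ Pmap f s
  Pmap-⊗ᴾ f r s = ≈ᴾ.trans (op-nat ⊗² f _) (op-⊗²-cong ≈ᴾ.refl ≈ᴾ.refl)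

  Ω-Pmap-id⊗ₘ≡⇒Hom : ∀ q a {x y} (e : x ≡ y) (r : P (a ⊗ₒ y)) →
                     Ω q a x (Pmap (id ⊗ₘ CP.≡⇒Hom e) r) ≈ᴾ Ω q a y r
  Ω-Pmap-id⊗ₘ≡⇒Hom q a refl r = Ω-cong q a _ (≈ᴾ.trans (Pmap-cong CP.id⊗ₘid r) (Pmap-id r))

  Eq-≡⇒Hom : ∀ {x y} (e : x ≡ y) →
             Pmap (CP.≡⇒Hom (≡.sym e) ⊗ₘ CP.≡⇒Hom (≡.sym e)) (Eq x) ≈ᴾ Eq y
  Eq-≡⇒Hom refl = ≈ᴾ.trans (Pmap-cong CP.id⊗ₘid _) (Pmap-id _)

  PEq-sym : ∀ {c c'} {r : P c} {s : P c'} → PEq r s → PEq s r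
  PEq-sym (refl , p) = refl , ≈ᴾ.sym p

  PEq-trans : ∀ {c c' c''} {r : P c} {s : P c'} {t : P c''} → PEq r s → PEq s t → PEq r t
  PEq-trans (refl , p) (refl , q) = refl , ≈ᴾ.trans p q

  PEq-antisym : ∀ {c c'} {r : P c} {s : P c'} → PLe r s → PLe s r → PEq r s
  PEq-antisym (refl , p) (refl , q) = refl , ≤ᴾ.antisym p q

  PEq⇒PLe : ∀ {c c'} {r : P c} {s : P c'} → PEq r s → PLe r s
  PEq⇒PLe (refl , p) = refl , ≤ᴾ.reflexive p

  PLe⇒≤ᴾ : ∀ {c} {r s : P c} → PLe r s → r ≤ᴾ s
  PLe⇒≤ᴾ (refl , p) = p

  PLe-resp-PEq : ∀ {c c' d d'} {r : P c} {r' : P c'} {s : P d} {s' : P d'} →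
                 PEq r r' → PEq s s' → PLe r s → PLe r' s'
  PLe-resp-PEq (refl , p) (refl , q) (refl , r≤s) = refl , ≤ᴾ-resp-≈ᴾ p q r≤s

  Pmap-≡⇒Hom-PEq : ∀ {x y} (e : x ≡ y) (r : P y) → PEq (Pmap (CP.≡⇒Hom e) r) r
  Pmap-≡⇒Hom-PEq refl r = refl , Pmap-id r

module MorProperties {𝕃 : Language} {A B : FAObj 𝕃} (G : Mor A B) where
  private
    module A = FAObj A
    module B = FAObj B
    module AC = FPCatProperties A.cat
    module BC = FPCatProperties B.cat
    module AP = PredicateProperties A
    module BP = PredicateProperties B
  open Mor G
  open Language 𝕃 using (⊗²; e⁰)

  Fp-cong : ∀ {c} {r s : A.P c} → r A.≈ᴾ s → Fp r B.≈ᴾ Fp s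
  Fp-cong p = BP.≤ᴾ.antisym (Fp-mono (AP.≤ᴾ.reflexive p)) (Fp-mono (AP.≤ᴾ.reflexive (AP.≈ᴾ.sym p)))

  Fp-eᴾ : ∀ {c} → Fp (A.eᴾ {c}) B.≈ᴾ B.eᴾ
  Fp-eᴾ = BP.≈ᴾ.trans (Fp-hom e⁰ (λ ())) BP.op-e⁰-cong

  Fp-⊗ᴾ : ∀ {c} (r s : A.P c) → Fp (r A.⊗ᴾ s) B.≈ᴾ Fp r B.⊗ᴾ Fp s
  Fp-⊗ᴾ r s = BP.≈ᴾ.trans (Fp-hom ⊗² _) (BP.op-⊗²-cong BP.≈ᴾ.refl BP.≈ᴾ.refl)

  aF∘Fm⟨⟩ : ∀ {a b c} (f : A.Hom c a) (g : A.Hom c b) → aF B.∘ Fm A.⟨ f , g ⟩ B.≈ B.⟨ Fm f , Fm g ⟩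
  aF∘Fm⟨⟩ f g = BC.≈.trans (BC.⟨⟩∘ (Fm A.π₁) (Fm A.π₂) (Fm A.⟨ f , g ⟩))
    (BC.⟨⟩-cong (BC.≈.trans (BC.≈.sym (Fm-∘ A.π₁ A.⟨ f , g ⟩)) (Fm-cong (A.π₁-β f g)))
                (BC.≈.trans (BC.≈.sym (Fm-∘ A.π₂ A.⟨ f , g ⟩)) (Fm-cong (A.π₂-β f g))))

  aF-monic : ∀ {a b c} {u v : B.Hom c (Fo (a A.⊗ₒ b))} → aF B.∘ u B.≈ aF B.∘ v → u B.≈ v
  aF-monic = BC.retraction⇒monic aF-invˡ

  Fo𝟙-unique₂ : ∀ {y} (f g : B.Hom y (Fo A.𝟙)) → f B.≈ g
  Fo𝟙-unique₂ f g = BC.retraction⇒monic 𝟙-invˡ (BC.!-unique₂ (B.! B.∘ f) (B.! B.∘ g))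

  Fm-HomEq : ∀ {a b a' b'} {f : A.Hom a b} {g : A.Hom a' b'} → A.HomEq f g → B.HomEq (Fm f) (Fm g)
  Fm-HomEq (refl , refl , p) = refl , refl , Fm-cong p

  Fp-PEq : ∀ {c c'} {r : A.P c} {s : A.P c'} → A.PEq r s → B.PEq (Fp r) (Fp s)
  Fp-PEq (refl , p) = refl , Fp-cong p

  Fp-PLe : ∀ {c c'} {r : A.P c} {s : A.P c'} → A.PLe r s → B.PLe (Fp r) (Fp s)
  Fp-PLe (refl , p) = refl , Fp-mono p

  Fm-conjugate-HomEq : ∀ {a b a' b'} (e : a ≡ a') (e' : b ≡ b') (g : A.Hom a' b') →
                       B.HomEq (Fm g) (Fm (AC.≡⇒Hom (≡.sym e') A.∘ (g A.∘ AC.≡⇒Hom e)))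
  Fm-conjugate-HomEq refl refl g =
    refl , refl , Fm-cong (AC.≈.sym (AC.≈.trans (A.identityˡ _) (A.identityʳ g)))

module PushforwardStructure {𝕃 : Language} {A B : FAObj 𝕃} (G : Mor A B) (Sg : Signature) where
  private
    module A = FAObj A
    module B = FAObj B
    module SA = Semantics A Sg
    module SB = Semantics B Sg
    module GP = MorProperties G
  open FPCatProperties B.cat
  open HomReasoning
  open FAObj B using (Hom; _∘_; _≈_; id; assoc; _⊗ₘ_; ⟨_,_⟩; π₁; π₂; !)
  open Mor G
  open Syntax 𝕃 Sg

  module _ (M : SA.Structure) where
    private
      module M = SA.Structure M

    -- F preserves products only up to aF, so F⟦Γ⟧ and the context object of the image sorts
    -- are merely isomorphic.
    ctxIso : ∀ Γ → Hom (Fo M.⟦ Γ ⟧ᶜ) (SB.ctxObj (Fo ∘′ M.⟦_⟧ˢ) Γ)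
    ctxIso ∅       = !
    ctxIso (Γ ▸ s) = (ctxIso Γ ⊗ₘ id) ∘ aF

    ctxIso⁻¹ : ∀ Γ → Hom (SB.ctxObj (Fo ∘′ M.⟦_⟧ˢ) Γ) (Fo M.⟦ Γ ⟧ᶜ)
    ctxIso⁻¹ ∅       = 𝟙-inv
    ctxIso⁻¹ (Γ ▸ s) = aF⁻¹ ∘ (ctxIso⁻¹ Γ ⊗ₘ id)

    ctxIso-inverseʳ : ∀ Γ → ctxIso Γ ∘ ctxIso⁻¹ Γ ≈ id
    ctxIso-inverseʳ ∅       = 𝟙-invʳ
    ctxIso-inverseʳ (Γ ▸ s) = begin
      ((ctxIso Γ ⊗ₘ id) ∘ aF) ∘ (aF⁻¹ ∘ (ctxIso⁻¹ Γ ⊗ₘ id)) ≈⟨ cancelInner _ _ aF-invʳ ⟩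
      (ctxIso Γ ⊗ₘ id) ∘ (ctxIso⁻¹ Γ ⊗ₘ id)                 ≈⟨ ⊗ₘ-inverse (ctxIso-inverseʳ Γ) (B.identityˡ id) ⟩
      id                                                    ∎

    ctxIso-inverseˡ : ∀ Γ → ctxIso⁻¹ Γ ∘ ctxIso Γ ≈ id
    ctxIso-inverseˡ ∅       = 𝟙-invˡ
    ctxIso-inverseˡ (Γ ▸ s) = begin
      (aF⁻¹ ∘ (ctxIso⁻¹ Γ ⊗ₘ id)) ∘ ((ctxIso Γ ⊗ₘ id) ∘ aF)
        ≈⟨ cancelInner _ _ (⊗ₘ-inverse (ctxIso-inverseˡ Γ) (B.identityˡ id)) ⟩
      aF⁻¹ ∘ aF                                               ≈⟨ aF-invˡ ⟩
      id                                                      ∎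

    pushforward : SB.Structure
    pushforward = record
      { ⟦_⟧ˢ = Fo ∘′ M.⟦_⟧ˢ
      ; ⟦_⟧ᶠ = λ {Δ} f → Fm M.⟦ f ⟧ᶠ ∘ ctxIso⁻¹ Δ
      ; ⟦_⟧ʳ = λ {Δ} R → B.Pmap (ctxIso⁻¹ Δ) (Fp M.⟦ R ⟧ʳ)
      }
    private
      module N = SB.Structure pushforward

    π₁∘ctxIso : ∀ {Γ s} → π₁ ∘ ctxIso (Γ ▸ s) ≈ ctxIso Γ ∘ Fm A.π₁
    π₁∘ctxIso {Γ} = begin
      π₁ ∘ ((ctxIso Γ ⊗ₘ id) ∘ aF) ≈⟨ sym-assoc _ _ _ ⟩
      (π₁ ∘ (ctxIso Γ ⊗ₘ id)) ∘ aF ≈⟨ ∘-congʳ (π₁∘⊗ₘ _ _) ⟩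
      (ctxIso Γ ∘ π₁) ∘ aF         ≈⟨ assoc _ _ _ ⟩
      ctxIso Γ ∘ (π₁ ∘ aF)         ≈⟨ ∘-congˡ (B.π₁-β _ _) ⟩
      ctxIso Γ ∘ Fm A.π₁           ∎

    π₂∘ctxIso : ∀ {Γ s} → π₂ ∘ ctxIso (Γ ▸ s) ≈ Fm A.π₂
    π₂∘ctxIso {Γ} = begin
      π₂ ∘ ((ctxIso Γ ⊗ₘ id) ∘ aF) ≈⟨ sym-assoc _ _ _ ⟩
      (π₂ ∘ (ctxIso Γ ⊗ₘ id)) ∘ aF ≈⟨ ∘-congʳ (≈.trans (π₂∘⊗ₘ _ _) (B.identityˡ _)) ⟩
      π₂ ∘ aF                      ≈⟨ B.π₂-β _ _ ⟩
      Fm A.π₂                      ∎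

    ⟦var⟧-pushforward : ∀ {Γ s} (x : Γ ∋ s) → N.⟦ x ⟧ᵛ ∘ ctxIso Γ ≈ Fm M.⟦ x ⟧ᵛ
    ⟦var⟧-pushforward {Γ ▸ s} here = π₂∘ctxIso {Γ} {s}
    ⟦var⟧-pushforward {Γ ▸ t} (there x) = begin
      (N.⟦ x ⟧ᵛ ∘ π₁) ∘ ctxIso (Γ ▸ t) ≈⟨ assoc _ _ _ ⟩
      N.⟦ x ⟧ᵛ ∘ (π₁ ∘ ctxIso (Γ ▸ t)) ≈⟨ ∘-congˡ (π₁∘ctxIso {Γ} {t}) ⟩
      N.⟦ x ⟧ᵛ ∘ (ctxIso Γ ∘ Fm A.π₁)  ≈⟨ sym-assoc _ _ _ ⟩
      (N.⟦ x ⟧ᵛ ∘ ctxIso Γ) ∘ Fm A.π₁  ≈⟨ ∘-congʳ (⟦var⟧-pushforward x) ⟩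
      Fm M.⟦ x ⟧ᵛ ∘ Fm A.π₁            ≈⟨ Fm-∘ _ _ ⟨
      Fm (M.⟦ x ⟧ᵛ A.∘ A.π₁)           ∎

    ⟦term⟧-pushforward : ∀ {Γ s} (t : Term Γ s) → N.⟦ t ⟧ᵗ ∘ ctxIso Γ ≈ Fm M.⟦ t ⟧ᵗ
    ⟦args⟧-pushforward : ∀ {Γ Δ} (ts : Args Γ Δ) → N.⟦ ts ⟧ᵃ ∘ ctxIso Γ ≈ ctxIso Δ ∘ Fm M.⟦ ts ⟧ᵃ
    ⟦term⟧-pushforward (var x) = ⟦var⟧-pushforward x
    ⟦term⟧-pushforward {Γ} (app {Δ} f ts) = begin
      ((Fm M.⟦ f ⟧ᶠ ∘ ctxIso⁻¹ Δ) ∘ N.⟦ ts ⟧ᵃ) ∘ ctxIso Γ    ≈⟨ assoc _ _ _ ⟩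
      (Fm M.⟦ f ⟧ᶠ ∘ ctxIso⁻¹ Δ) ∘ (N.⟦ ts ⟧ᵃ ∘ ctxIso Γ)    ≈⟨ ∘-congˡ (⟦args⟧-pushforward ts) ⟩
      (Fm M.⟦ f ⟧ᶠ ∘ ctxIso⁻¹ Δ) ∘ (ctxIso Δ ∘ Fm M.⟦ ts ⟧ᵃ) ≈⟨ cancelInner _ _ (ctxIso-inverseˡ Δ) ⟩
      Fm M.⟦ f ⟧ᶠ ∘ Fm M.⟦ ts ⟧ᵃ                             ≈⟨ Fm-∘ _ _ ⟨
      Fm (M.⟦ f ⟧ᶠ A.∘ M.⟦ ts ⟧ᵃ)                            ∎
    ⟦args⟧-pushforward ∅ = !-unique₂ _ _
    ⟦args⟧-pushforward {Γ} (_,_ {Δ} ts t) = begin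
      ⟨ N.⟦ ts ⟧ᵃ , N.⟦ t ⟧ᵗ ⟩ ∘ ctxIso Γ                        ≈⟨ ⟨⟩∘ _ _ _ ⟩
      ⟨ N.⟦ ts ⟧ᵃ ∘ ctxIso Γ , N.⟦ t ⟧ᵗ ∘ ctxIso Γ ⟩
        ≈⟨ ⟨⟩-cong (⟦args⟧-pushforward ts) (≈.trans (⟦term⟧-pushforward t) (≈.sym (B.identityˡ _))) ⟩
      ⟨ ctxIso Δ ∘ Fm M.⟦ ts ⟧ᵃ , id ∘ Fm M.⟦ t ⟧ᵗ ⟩              ≈⟨ ⊗ₘ∘⟨⟩ _ _ _ _ ⟨
      (ctxIso Δ ⊗ₘ id) ∘ ⟨ Fm M.⟦ ts ⟧ᵃ , Fm M.⟦ t ⟧ᵗ ⟩           ≈⟨ ∘-congˡ (GP.aF∘Fm⟨⟩ _ _) ⟨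
      (ctxIso Δ ⊗ₘ id) ∘ (aF ∘ Fm A.⟨ M.⟦ ts ⟧ᵃ , M.⟦ t ⟧ᵗ ⟩)     ≈⟨ sym-assoc _ _ _ ⟩
      ctxIso (Δ ▸ _) ∘ Fm A.⟨ M.⟦ ts ⟧ᵃ , M.⟦ t ⟧ᵗ ⟩              ∎

module PushforwardSatisfaction {𝕃 : Language} {A B : FAObj 𝕃} (G : Mor A B) (Sg : Signature) where
  private
    module A = FAObj A
    module B = FAObj B
    module BC = FPCatProperties B.cat
    module SA = Semantics A Sg
    module SB = Semantics B Sg
    module GP = MorProperties G
  open PredicateProperties B
  open PReasoning
  open FAObj B using (_∘_; _≈_; id; _⊗ₘ_; ⟨_,_⟩; Pmap; _≈ᴾ_)
  open Mor G
  open Syntax 𝕃 Sg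
  open PushforwardStructure G Sg

  module _ (M : SA.Structure) where
    private
      module M = SA.Structure M
      module N = SB.Structure (pushforward M)
      ι = ctxIso M
      ι⁻¹ = ctxIso⁻¹ M

    ⟦formula⟧-pushforward : ∀ {Γ} (φ : Formula Γ) → Pmap (ι Γ) N.⟦ φ ⟧ᵩ ≈ᴾ Fp M.⟦ φ ⟧ᵩ
    ⟦formula⟧-pushforward {Γ} (rel {Δ = Δ} R ts) = begin
      Pmap (ι Γ) (Pmap N.⟦ ts ⟧ᵃ (Pmap (ι⁻¹ Δ) (Fp M.⟦ R ⟧ʳ))) ≈⟨ B.Pmap-∘ _ _ _ ⟨
      Pmap (N.⟦ ts ⟧ᵃ ∘ ι Γ) (Pmap (ι⁻¹ Δ) (Fp M.⟦ R ⟧ʳ))      ≈⟨ B.Pmap-∘ _ _ _ ⟨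
      Pmap (ι⁻¹ Δ ∘ (N.⟦ ts ⟧ᵃ ∘ ι Γ)) (Fp M.⟦ R ⟧ʳ)           ≈⟨ B.Pmap-cong args≈ _ ⟩
      Pmap (Fm M.⟦ ts ⟧ᵃ) (Fp M.⟦ R ⟧ʳ)                        ≈⟨ Fp-nat _ _ ⟨
      Fp (A.Pmap M.⟦ ts ⟧ᵃ M.⟦ R ⟧ʳ)                           ∎
      where
      args≈ : ι⁻¹ Δ ∘ (N.⟦ ts ⟧ᵃ ∘ ι Γ) ≈ Fm M.⟦ ts ⟧ᵃ
      args≈ = BC.≈.trans (BC.∘-congˡ (⟦args⟧-pushforward M ts)) (BC.cancelˡ _ (ctxIso-inverseˡ M Δ))
    ⟦formula⟧-pushforward {Γ} (t ≐ u) = begin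
      Pmap (ι Γ) (Pmap ⟨ N.⟦ t ⟧ᵗ , N.⟦ u ⟧ᵗ ⟩ (B.Eq _))     ≈⟨ B.Pmap-∘ _ _ _ ⟨
      Pmap (⟨ N.⟦ t ⟧ᵗ , N.⟦ u ⟧ᵗ ⟩ ∘ ι Γ) (B.Eq _)          ≈⟨ B.Pmap-cong pair≈ _ ⟩
      Pmap (aF ∘ Fm A.⟨ M.⟦ t ⟧ᵗ , M.⟦ u ⟧ᵗ ⟩) (B.Eq _)      ≈⟨ B.Pmap-∘ _ _ _ ⟩
      Pmap (Fm A.⟨ M.⟦ t ⟧ᵗ , M.⟦ u ⟧ᵗ ⟩) (Pmap aF (B.Eq _)) ≈⟨ Pmap-resp-≈ᴾ _ (Fp-Eq _) ⟨
      Pmap (Fm A.⟨ M.⟦ t ⟧ᵗ , M.⟦ u ⟧ᵗ ⟩) (Fp (A.Eq _))      ≈⟨ Fp-nat _ _ ⟨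
      Fp (A.Pmap A.⟨ M.⟦ t ⟧ᵗ , M.⟦ u ⟧ᵗ ⟩ (A.Eq _))         ∎
      where
      pair≈ : ⟨ N.⟦ t ⟧ᵗ , N.⟦ u ⟧ᵗ ⟩ ∘ ι Γ ≈ aF ∘ Fm A.⟨ M.⟦ t ⟧ᵗ , M.⟦ u ⟧ᵗ ⟩
      pair≈ = BC.≈.trans (BC.⟨⟩∘ _ _ _)
        (BC.≈.trans (BC.⟨⟩-cong (⟦term⟧-pushforward M t) (⟦term⟧-pushforward M u)) (BC.≈.sym (GP.aF∘Fm⟨⟩ _ _)))
    ⟦formula⟧-pushforward {Γ} (conn σ φs) = begin
      Pmap (ι Γ) (B.op σ (λ i → N.⟦ φs i ⟧ᵩ)) ≈⟨ B.op-nat σ _ _ ⟩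
      B.op σ (λ i → Pmap (ι Γ) N.⟦ φs i ⟧ᵩ)   ≈⟨ B.op-cong σ (λ i → ⟦formula⟧-pushforward (φs i)) ⟩
      B.op σ (λ i → Fp M.⟦ φs i ⟧ᵩ)           ≈⟨ Fp-hom σ _ ⟨
      Fp (A.op σ (λ i → M.⟦ φs i ⟧ᵩ))         ∎
    ⟦formula⟧-pushforward {Γ} (quant q s φ) = begin
      Pmap (ι Γ) (B.Ω q _ _ N.⟦ φ ⟧ᵩ)       ≈⟨ B.Ω-nat q _ (ι Γ) _ ⟨
      B.Ω q _ _ (Pmap (ι Γ ⊗ₘ id) N.⟦ φ ⟧ᵩ) ≈⟨ B.Ω-cong q _ _ body ⟩
      B.Ω q _ _ (Pmap aF⁻¹ (Fp M.⟦ φ ⟧ᵩ))   ≈⟨ Fp-Ω q _ _ _ ⟨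
      Fp (A.Ω q _ _ M.⟦ φ ⟧ᵩ)               ∎
      where
      body : Pmap (ι Γ ⊗ₘ id) N.⟦ φ ⟧ᵩ ≈ᴾ Pmap aF⁻¹ (Fp M.⟦ φ ⟧ᵩ)
      body = begin
        Pmap (ι Γ ⊗ₘ id) N.⟦ φ ⟧ᵩ                 ≈⟨ B.Pmap-cong (BC.cancelʳ _ aF-invʳ) _ ⟨
        Pmap (((ι Γ ⊗ₘ id) ∘ aF) ∘ aF⁻¹) N.⟦ φ ⟧ᵩ ≈⟨ B.Pmap-∘ _ _ _ ⟩
        Pmap aF⁻¹ (Pmap (ι (Γ ▸ s)) N.⟦ φ ⟧ᵩ)     ≈⟨ Pmap-resp-≈ᴾ _ (⟦formula⟧-pushforward φ) ⟩
        Pmap aF⁻¹ (Fp M.⟦ φ ⟧ᵩ)                   ∎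

    ⟦formulas⟧-pushforward : ∀ {Γ} (φs : List (Formula Γ)) → Pmap (ι Γ) N.⟦ φs ⟧ᴸ ≈ᴾ Fp M.⟦ φs ⟧ᴸ
    ⟦formulas⟧-pushforward [] = ≈ᴾ.trans (Pmap-eᴾ _) (≈ᴾ.sym GP.Fp-eᴾ)
    ⟦formulas⟧-pushforward (φ ∷ φs) = ≈ᴾ.trans (Pmap-⊗ᴾ _ _ _)
      (≈ᴾ.trans (⊗ᴾ-cong (⟦formula⟧-pushforward φ) (⟦formulas⟧-pushforward φs)) (≈ᴾ.sym (GP.Fp-⊗ᴾ _ _)))

    satisfies-pushforward : ∀ a → M.Satisfies a → N.Satisfies a
    satisfies-pushforward (eqn Γ t u) t≈u = BC.section⇒epic (ctxIso-inverseʳ M Γ)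
      (BC.≈.trans (⟦term⟧-pushforward M t) (BC.≈.trans (Fm-cong t≈u) (BC.≈.sym (⟦term⟧-pushforward M u))))
    satisfies-pushforward (seq Γ φs φ) φs≤φ = ≤ᴾ-resp-≈ᴾ (Pmap-inverse (ctxIso-inverseʳ M Γ) _)
      (Pmap-inverse (ctxIso-inverseʳ M Γ) _) (B.Pmap-mono (ι⁻¹ Γ)
        (≤ᴾ-resp-≈ᴾ (≈ᴾ.sym (⟦formulas⟧-pushforward φs)) (≈ᴾ.sym (⟦formula⟧-pushforward φ)) (Fp-mono φs≤φ)))

    satisfies-reflected : InM G → ∀ a → N.Satisfies a → M.Satisfies a
    satisfies-reflected (faithful , reflects-≤) (eqn Γ t u) t≈u = faithful
      (BC.≈.trans (BC.≈.sym (⟦term⟧-pushforward M t)) (BC.≈.trans (BC.∘-congʳ t≈u) (⟦term⟧-pushforward M u)))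
    satisfies-reflected (faithful , reflects-≤) (seq Γ φs φ) φs≤φ = reflects-≤
      (≤ᴾ-resp-≈ᴾ (⟦formulas⟧-pushforward φs) (⟦formula⟧-pushforward φ) (B.Pmap-mono (ι Γ) φs≤φ))

subprop-reflects-IsFAL : {𝕃 : Language} (L : Logic 𝕃) {A : FAObj 𝕃} (B : FALObj L) (ι : Mor A (obj B)) →
                         InM ι → IsFAL L A
subprop-reflects-IsFAL L B ι ι∈M Sg T T' T⊢T' M M⊨T a T'a =
  satisfies-reflected M ι∈M a
    (isFAL B Sg T T' T⊢T' (pushforward M) (λ a' Ta' → satisfies-pushforward M a' (M⊨T a' Ta')) a T'a)
  where
  open PushforwardStructure ι Sg
  open PushforwardSatisfaction ι Sg

module Image {𝕃 : Language} {X Y : FAObj 𝕃} (F : Mor X Y) where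
  private
    module X = FAObj X
    module Y = FAObj Y
    module XC = FPCatProperties X.cat
    module YC = FPCatProperties Y.cat
    module XP = PredicateProperties X
    module YP = PredicateProperties Y
    module FP = MorProperties F
  open Mor F

  image-cat : FPCat
  image-cat = record
    { Obj       = X.Obj
    ; Hom       = X.Hom
    ; _≈_       = λ f g → Fm f Y.≈ Fm g
    ; ≈-equiv   = record { refl = YC.≈.refl ; sym = YC.≈.sym ; trans = YC.≈.trans }
    ; id        = X.id
    ; _∘_       = X._∘_
    ; ∘-cong    = λ p q → YC.≈.trans (Fm-∘ _ _) (YC.≈.trans (Y.∘-cong p q) (YC.≈.sym (Fm-∘ _ _)))
    ; identityˡ = λ f → Fm-cong (X.identityˡ f)
    ; identityʳ = λ f → Fm-cong (X.identityʳ f)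
    ; assoc     = λ f g h → Fm-cong (X.assoc f g h)
    ; 𝟙         = X.𝟙
    ; !         = X.!
    ; !-unique  = λ f → FP.Fo𝟙-unique₂ _ _
    ; _⊗ₒ_      = X._⊗ₒ_
    ; π₁        = X.π₁
    ; π₂        = X.π₂
    ; ⟨_,_⟩     = X.⟨_,_⟩
    ; π₁-β      = λ f g → Fm-cong (X.π₁-β f g)
    ; π₂-β      = λ f g → Fm-cong (X.π₂-β f g)
    ; ⟨⟩-unique = λ {_ _ _ f g} h p q → FP.aF-monic
        (YC.≈.trans (YC.⟨⟩∘ _ _ _)
        (YC.≈.trans (YC.⟨⟩-cong (YC.≈.trans (YC.≈.sym (Fm-∘ _ _)) p) (YC.≈.trans (YC.≈.sym (Fm-∘ _ _)) q))
                    (YC.≈.sym (FP.aF∘Fm⟨⟩ f g))))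
    }

  image : FAObj 𝕃
  image = record
    { cat         = image-cat
    ; P           = X.P
    ; _≈ᴾ_        = λ r s → Fp r Y.≈ᴾ Fp s
    ; _≤ᴾ_        = λ r s → Fp r Y.≤ᴾ Fp s
    ; isPO        = record
      { isPreorder = record
        { isEquivalence = record { refl = YP.≈ᴾ.refl ; sym = YP.≈ᴾ.sym ; trans = YP.≈ᴾ.trans }
        ; reflexive     = YP.≤ᴾ.reflexive
        ; trans         = YP.≤ᴾ.trans }
      ; antisym    = YP.≤ᴾ.antisym }
    ; Pmap        = X.Pmap
    ; Pmap-mono   = λ f r≤s → YP.≤ᴾ-resp-≈ᴾ (YP.≈ᴾ.sym (Fp-nat f _)) (YP.≈ᴾ.sym (Fp-nat f _)) (Y.Pmap-mono (Fm f) r≤s)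
    ; Pmap-cong   = λ {_ _ f g} f≈g r → YP.≈ᴾ.trans (Fp-nat f r)
        (YP.≈ᴾ.trans (Y.Pmap-cong f≈g (Fp r)) (YP.≈ᴾ.sym (Fp-nat g r)))
    ; Pmap-id     = λ r → FP.Fp-cong (X.Pmap-id r)
    ; Pmap-∘      = λ f g r → FP.Fp-cong (X.Pmap-∘ f g r)
    ; op          = X.op
    ; op-cong     = λ σ ps → YP.≈ᴾ.trans (Fp-hom σ _) (YP.≈ᴾ.trans (Y.op-cong σ ps) (YP.≈ᴾ.sym (Fp-hom σ _)))
    ; op-nat      = λ σ f rs → FP.Fp-cong (X.op-nat σ f rs)
    ; Eq          = X.Eq
    ; Ω           = X.Ω
    ; Ω-cong      = λ q b c p → YP.≈ᴾ.trans (Fp-Ω q b c _)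
        (YP.≈ᴾ.trans (Y.Ω-cong q _ _ (YP.Pmap-resp-≈ᴾ aF⁻¹ p)) (YP.≈ᴾ.sym (Fp-Ω q b c _)))
    ; Ω-nat       = λ q c f r → FP.Fp-cong (X.Ω-nat q c f r)
    -- The ⊗ and e of image are fresh pattern lambdas, only pointwise equal to those of X.
    ; ⊗-assoc     = λ r s t → FP.Fp-cong (XP.≈ᴾ.trans (XP.op-⊗²-cong (XP.op-⊗²-cong XP.≈ᴾ.refl XP.≈ᴾ.refl) XP.≈ᴾ.refl)
        (XP.≈ᴾ.trans (X.⊗-assoc r s t) (XP.op-⊗²-cong XP.≈ᴾ.refl (XP.op-⊗²-cong XP.≈ᴾ.refl XP.≈ᴾ.refl))))
    ; ⊗-identityˡ = λ r → FP.Fp-cong (XP.≈ᴾ.trans (XP.op-⊗²-cong XP.op-e⁰-cong XP.≈ᴾ.refl) (X.⊗-identityˡ r))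
    ; ⊗-identityʳ = λ r → FP.Fp-cong (XP.≈ᴾ.trans (XP.op-⊗²-cong XP.≈ᴾ.refl XP.op-e⁰-cong) (X.⊗-identityʳ r))
    ; Ω-unit      = λ q b r → FP.Fp-cong (X.Ω-unit q b r)
    ; Ω-assoc     = λ q b c d r → FP.Fp-cong (X.Ω-assoc q b c d r)
    ; Eq-𝟙        = FP.Fp-cong (XP.≈ᴾ.trans X.Eq-𝟙 XP.op-e⁰-cong)
    ; Eq-⊗        = λ c₁ c₂ → FP.Fp-cong (XP.≈ᴾ.trans (X.Eq-⊗ c₁ c₂) (XP.op-⊗²-cong XP.≈ᴾ.refl XP.≈ᴾ.refl))
    }

  ε : Mor X image
  ε = record
    { Fo      = λ c → c
    ; Fm      = λ f → f
    ; Fm-cong = Fm-cong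
    ; Fm-id   = YC.≈.refl
    ; Fm-∘    = λ _ _ → YC.≈.refl
    ; 𝟙-inv   = X.id
    ; 𝟙-invˡ  = Fm-cong (XC.!-unique₂ _ _)
    ; 𝟙-invʳ  = Fm-cong (XC.!-unique₂ _ _)
    ; aF⁻¹    = X.id
    ; aF-invˡ = Fm-cong (XC.≈.trans (X.identityˡ _) XC.⟨π₁,π₂⟩≈id)
    ; aF-invʳ = Fm-cong (XC.≈.trans (X.identityʳ _) XC.⟨π₁,π₂⟩≈id)
    ; Fp      = λ r → r
    ; Fp-mono = Fp-mono
    ; Fp-nat  = λ _ _ → YP.≈ᴾ.refl
    ; Fp-hom  = λ _ _ → YP.≈ᴾ.refl
    ; Fp-Ω    = λ q b c r → FP.Fp-cong (X.Ω-cong q b c (XP.≈ᴾ.sym (X.Pmap-id r)))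
    ; Fp-Eq   = λ c → FP.Fp-cong (XP.≈ᴾ.sym (XP.≈ᴾ.trans (X.Pmap-cong XC.⟨π₁,π₂⟩≈id _) (X.Pmap-id _)))
    }

  ψ : Mor image Y
  ψ = record
    { Fo      = Fo
    ; Fm      = Fm
    ; Fm-cong = λ p → p
    ; Fm-id   = Fm-id
    ; Fm-∘    = Fm-∘
    ; 𝟙-inv   = 𝟙-inv
    ; 𝟙-invˡ  = 𝟙-invˡ
    ; 𝟙-invʳ  = 𝟙-invʳ
    ; aF⁻¹    = aF⁻¹
    ; aF-invˡ = aF-invˡ
    ; aF-invʳ = aF-invʳ
    ; Fp      = Fp
    ; Fp-mono = λ r≤s → r≤s
    ; Fp-nat  = Fp-nat
    ; Fp-hom  = Fp-hom
    ; Fp-Ω    = Fp-Ω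
    ; Fp-Eq   = Fp-Eq
    }

  ε∈E : InE ε
  ε∈E = (λ _ _ e → e) , (λ d → d , refl) , (λ g → g , YC.≈.refl) , (λ r → r , YP.≈ᴾ.refl)

  ψ∈M : InM ψ
  ψ∈M = (λ p → p) , (λ r≤s → r≤s)

  ψ∘ε≡F : CompEq ψ ε F
  ψ∘ε≡F = (λ _ → refl) , (λ _ → refl , refl , YC.≈.refl) , (λ _ → refl , YP.≈ᴾ.refl)

E-M-factorisation : {𝕃 : Language} (L : Logic 𝕃) (X Y : FALObj L) (F : Mor (obj X) (obj Y)) →
  Σ (FALObj L) λ I → Σ (Mor (obj X) (obj I)) λ ε → Σ (Mor (obj I) (obj Y)) λ ψ →
    InE ε × InM ψ × CompEq ψ ε F
E-M-factorisation L X Y F =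
  record { obj = image ; isFAL = subprop-reflects-IsFAL L Y ψ ψ∈M } , ε , ψ , ε∈E , ψ∈M , ψ∘ε≡F
  where open Image F

module _ {𝕃 : Language} {X Y Z : FAObj 𝕃} {F : Mor X Y} {K : Mor X Z} where
  private
    module Y = FAObj Y
    module YC = FPCatProperties Y.cat
    module YP = PredicateProperties Y

  CompEq⇒KerLe : (H : Mor Z Y) → CompEq H K F → KerLe K F
  CompEq⇒KerLe H (HK≡F-obj , HK≡F-hom , HK≡F-pred) =
    (λ c₁ c₂ e → ≡.trans (≡.sym (HK≡F-obj c₁)) (≡.trans (≡.cong (Mor.Fo H) e) (HK≡F-obj c₂))) ,
    (λ f₁ f₂ Kf₁≡Kf₂ → YC.HomEq-trans (YC.HomEq-sym (HK≡F-hom f₁))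
                         (YC.HomEq-trans (MorProperties.Fm-HomEq H Kf₁≡Kf₂) (HK≡F-hom f₂))) ,
    (λ r₁ r₂ Kr₁≤Kr₂ → YP.PLe-resp-PEq (HK≡F-pred r₁) (HK≡F-pred r₂) (MorProperties.Fp-PLe H Kr₁≤Kr₂))

module Lifting {𝕃 : Language} {X Y Z : FAObj 𝕃} (F : Mor X Y) (K : Mor X Z)
               (K-fullSurj : FullSurj K) (K≤F : KerLe K F) where
  private
    module X = FAObj X
    module Y = FAObj Y
    module Z = FAObj Z
    module YC = FPCatProperties Y.cat
    module ZC = FPCatProperties Z.cat
    module YP = PredicateProperties Y
    module ZP = PredicateProperties Z
    module F = Mor F
    module K = Mor K
    module FP = MorProperties F
    module KP = MorProperties K

  lift : ∀ {a b} → Z.Hom (K.Fo a) (K.Fo b) → X.Hom a b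
  lift g = proj₁ (proj₁ K-fullSurj g)

  K-lift : ∀ {a b} (g : Z.Hom (K.Fo a) (K.Fo b)) → K.Fm (lift g) Z.≈ g
  K-lift g = proj₂ (proj₁ K-fullSurj g)

  ob : Z.Obj → X.Obj
  ob d = proj₁ (proj₁ (proj₂ K-fullSurj) d)

  K-ob : ∀ d → K.Fo (ob d) ≡ d
  K-ob d = proj₂ (proj₁ (proj₂ K-fullSurj) d)

  liftᴾ : ∀ {a} → Z.P (K.Fo a) → X.P a
  liftᴾ r = proj₁ (proj₂ (proj₂ K-fullSurj) r)

  K-liftᴾ : ∀ {a} (r : Z.P (K.Fo a)) → K.Fp (liftᴾ r) Z.≈ᴾ r
  K-liftᴾ r = proj₂ (proj₂ (proj₂ K-fullSurj) r)

  ker-HomEq : ∀ {a b a' b'} {f : X.Hom a b} {g : X.Hom a' b'} → Z.HomEq (K.Fm f) (K.Fm g) →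
              Y.HomEq (F.Fm f) (F.Fm g)
  ker-HomEq = proj₁ (proj₂ K≤F) _ _

  ker-PEq : ∀ {a a'} {r : X.P a} {s : X.P a'} → Z.PEq (K.Fp r) (K.Fp s) → Y.PEq (F.Fp r) (F.Fp s)
  ker-PEq Kr≡Ks = YP.PEq-antisym (proj₂ (proj₂ K≤F) _ _ (ZP.PEq⇒PLe Kr≡Ks))
                                 (proj₂ (proj₂ K≤F) _ _ (ZP.PEq⇒PLe (ZP.PEq-sym Kr≡Ks)))

  ker-≈ : ∀ {a b} {f g : X.Hom a b} → K.Fm f Z.≈ K.Fm g → F.Fm f Y.≈ F.Fm g
  ker-≈ Kf≈Kg = YC.HomEq⇒≈ (ker-HomEq (refl , refl , Kf≈Kg))

  ker-≤ᴾ : ∀ {a} {r s : X.P a} → K.Fp r Z.≤ᴾ K.Fp s → F.Fp r Y.≤ᴾ F.Fp s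
  ker-≤ᴾ Kr≤Ks = YP.PLe⇒≤ᴾ (proj₂ (proj₂ K≤F) _ _ (refl , Kr≤Ks))

  ker-≈ᴾ : ∀ {a} {r s : X.P a} → K.Fp r Z.≈ᴾ K.Fp s → F.Fp r Y.≈ᴾ F.Fp s
  ker-≈ᴾ Kr≈Ks = YP.≤ᴾ.antisym (ker-≤ᴾ (ZP.≤ᴾ.reflexive Kr≈Ks)) (ker-≤ᴾ (ZP.≤ᴾ.reflexive (ZP.≈ᴾ.sym Kr≈Ks)))

  θ : ∀ d → Z.Hom (K.Fo (ob d)) d
  θ d = ZC.≡⇒Hom (K-ob d)

  θ⁻¹ : ∀ d → Z.Hom d (K.Fo (ob d))
  θ⁻¹ d = ZC.≡⇒Hom (≡.sym (K-ob d))

  θ∘θ⁻¹ : ∀ d → θ d Z.∘ θ⁻¹ d Z.≈ Z.id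
  θ∘θ⁻¹ d = ZC.≡⇒Hom-inverseʳ (K-ob d)

  θ⁻¹∘θ : ∀ d → θ⁻¹ d Z.∘ θ d Z.≈ Z.id
  θ⁻¹∘θ d = ZC.≡⇒Hom-inverseˡ (K-ob d)

  conj : ∀ {d d'} → Z.Hom d d' → Z.Hom (K.Fo (ob d)) (K.Fo (ob d'))
  conj {d} {d'} g = θ⁻¹ d' Z.∘ (g Z.∘ θ d)

  conj-∘ : ∀ {d d' d''} (g : Z.Hom d' d'') (h : Z.Hom d d') → conj (g Z.∘ h) Z.≈ conj g Z.∘ conj h
  conj-∘ {d} {d'} {d''} g h = begin
    θ⁻¹ d'' ∘ ((g ∘ h) ∘ θ d)                     ≈⟨ ∘-congˡ (assoc _ _ _) ⟩
    θ⁻¹ d'' ∘ (g ∘ (h ∘ θ d))                     ≈⟨ sym-assoc _ _ _ ⟩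
    (θ⁻¹ d'' ∘ g) ∘ (h ∘ θ d)                     ≈⟨ cancelInner _ _ (θ∘θ⁻¹ d') ⟨
    ((θ⁻¹ d'' ∘ g) ∘ θ d') ∘ (θ⁻¹ d' ∘ (h ∘ θ d)) ≈⟨ ∘-congʳ (assoc _ _ _) ⟩
    (θ⁻¹ d'' ∘ (g ∘ θ d')) ∘ (θ⁻¹ d' ∘ (h ∘ θ d)) ∎
    where
    open ZC
    open HomReasoning
    open FAObj Z using (_∘_; assoc)

  liftHom : ∀ {d d'} → Z.Hom d d' → X.Hom (ob d) (ob d')
  liftHom g = lift (conj g)

  K-liftHom : ∀ {d d'} (g : Z.Hom d d') → K.Fm (liftHom g) Z.≈ conj g
  K-liftHom g = K-lift (conj g)

  θ∘K-liftHom : ∀ {d d'} (g : Z.Hom d d') → θ d' Z.∘ K.Fm (liftHom g) Z.≈ g Z.∘ θ d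
  θ∘K-liftHom g = ZC.≈.trans (ZC.∘-congˡ (K-liftHom g)) (ZC.cancelˡ _ (θ∘θ⁻¹ _))

  HFo : Z.Obj → Y.Obj
  HFo d = F.Fo (ob d)

  HFm : ∀ {a b} → Z.Hom a b → Y.Hom (HFo a) (HFo b)
  HFm g = F.Fm (liftHom g)

  HFm-cong : ∀ {a b} {f g : Z.Hom a b} → f Z.≈ g → HFm f Y.≈ HFm g
  HFm-cong f≈g = ker-≈ (ZC.≈.trans (K-liftHom _)
    (ZC.≈.trans (ZC.∘-congˡ (ZC.∘-congʳ f≈g)) (ZC.≈.sym (K-liftHom _))))

  HFm-id : ∀ {a} → HFm (Z.id {a}) Y.≈ Y.id
  HFm-id {a} = YC.≈.trans (ker-≈ K-liftHom-id) F.Fm-id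
    where
    K-liftHom-id : K.Fm (liftHom (Z.id {a})) Z.≈ K.Fm X.id
    K-liftHom-id = ZC.≈.trans (K-liftHom _)
      (ZC.≈.trans (ZC.∘-congˡ (Z.identityˡ _)) (ZC.≈.trans (θ⁻¹∘θ a) (ZC.≈.sym K.Fm-id)))

  HFm-∘ : ∀ {a b d} (f : Z.Hom b d) (g : Z.Hom a b) → HFm (f Z.∘ g) Y.≈ HFm f Y.∘ HFm g
  HFm-∘ f g = YC.≈.trans (ker-≈ K-liftHom-∘) (F.Fm-∘ _ _)
    where
    K-liftHom-∘ : K.Fm (liftHom (f Z.∘ g)) Z.≈ K.Fm (liftHom f X.∘ liftHom g)
    K-liftHom-∘ = ZC.≈.trans (K-liftHom _) (ZC.≈.trans (conj-∘ f g)
      (ZC.≈.sym (ZC.≈.trans (K.Fm-∘ _ _) (Z.∘-cong (K-liftHom f) (K-liftHom g)))))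

  H𝟙-inv : Y.Hom Y.𝟙 (HFo Z.𝟙)
  H𝟙-inv = F.Fm (lift (θ⁻¹ Z.𝟙 Z.∘ Z.!)) Y.∘ F.𝟙-inv

  H𝟙-invˡ : H𝟙-inv Y.∘ Y.! Y.≈ Y.id
  H𝟙-invˡ = begin
    (F.Fm u ∘ F.𝟙-inv) ∘ !              ≈⟨ ∘-congˡ (!-unique₂ _ _) ⟩
    (F.Fm u ∘ F.𝟙-inv) ∘ (! ∘ F.Fm X.!) ≈⟨ cancelInner _ _ F.𝟙-invˡ ⟩
    F.Fm u ∘ F.Fm X.!                   ≈⟨ F.Fm-∘ _ _ ⟨
    F.Fm (u X.∘ X.!)                    ≈⟨ ker-≈ K-u∘! ⟩
    F.Fm X.id                           ≈⟨ F.Fm-id ⟩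
    id                                  ∎
    where
    open YC
    open HomReasoning
    open FAObj Y using (_∘_; id; !)
    u = lift (θ⁻¹ Z.𝟙 Z.∘ Z.!)
    K-u∘! : K.Fm (u X.∘ X.!) Z.≈ K.Fm X.id
    K-u∘! = ZC.≈.trans (K.Fm-∘ _ _) (ZC.≈.trans (ZC.∘-congʳ (K-lift _))
      (ZC.≈.trans (Z.assoc _ _ _) (ZC.≈.trans (ZC.∘-congˡ (ZC.!-unique₂ _ _))
      (ZC.≈.trans (θ⁻¹∘θ Z.𝟙) (ZC.≈.sym K.Fm-id)))))

  Φ : ∀ {b d} → Z.Hom (K.Fo (ob b) Z.⊗ₒ K.Fo (ob d)) (b Z.⊗ₒ d)
  Φ {b} {d} = θ b Z.⊗ₘ θ d

  Φ⁻¹ : ∀ {b d} → Z.Hom (b Z.⊗ₒ d) (K.Fo (ob b) Z.⊗ₒ K.Fo (ob d))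
  Φ⁻¹ {b} {d} = θ⁻¹ b Z.⊗ₘ θ⁻¹ d

  liftHom-π₁ : ∀ {b d} → X.Hom (ob (b Z.⊗ₒ d)) (ob b)
  liftHom-π₁ = liftHom Z.π₁

  liftHom-π₂ : ∀ {b d} → X.Hom (ob (b Z.⊗ₒ d)) (ob d)
  liftHom-π₂ = liftHom Z.π₂

  unpair : ∀ {b d} → X.Hom (ob b X.⊗ₒ ob d) (ob (b Z.⊗ₒ d))
  unpair {b} {d} = lift (θ⁻¹ (b Z.⊗ₒ d) Z.∘ (Φ Z.∘ K.aF))

  pair : ∀ {b d} → X.Hom (ob (b Z.⊗ₒ d)) (ob b X.⊗ₒ ob d)
  pair = X.⟨ liftHom-π₁ , liftHom-π₂ ⟩

  K-pair : ∀ {b d} → K.Fm (pair {b} {d}) Z.≈ K.aF⁻¹ Z.∘ (Φ⁻¹ Z.∘ θ (b Z.⊗ₒ d))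
  K-pair {b} {d} = begin
    K.Fm X.⟨ liftHom-π₁ , liftHom-π₂ ⟩                   ≈⟨ cancelˡ _ K.aF-invˡ ⟨
    K.aF⁻¹ ∘ (K.aF ∘ K.Fm X.⟨ liftHom-π₁ , liftHom-π₂ ⟩) ≈⟨ ∘-congˡ (KP.aF∘Fm⟨⟩ _ _) ⟩
    K.aF⁻¹ ∘ ⟨ K.Fm liftHom-π₁ , K.Fm liftHom-π₂ ⟩       ≈⟨ ∘-congˡ (⟨⟩-cong (K-liftHom _) (K-liftHom _)) ⟩
    K.aF⁻¹ ∘ ⟨ conj π₁ , conj π₂ ⟩                       ≈⟨ ∘-congˡ (⟨⟩-cong (sym-assoc _ _ _) (sym-assoc _ _ _)) ⟩
    K.aF⁻¹ ∘ ⟨ (θ⁻¹ b ∘ π₁) ∘ θ m , (θ⁻¹ d ∘ π₂) ∘ θ m ⟩ ≈⟨ ∘-congˡ (⟨⟩∘ _ _ _) ⟨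
    K.aF⁻¹ ∘ (Φ⁻¹ ∘ θ m)                                 ∎
    where
    open ZC
    open HomReasoning
    open FAObj Z using (_∘_; ⟨_,_⟩; π₁; π₂)
    m = b Z.⊗ₒ d

  F-unpair∘pair : ∀ {b d} → F.Fm (unpair {b} {d}) Y.∘ F.Fm pair Y.≈ Y.id
  F-unpair∘pair {b} {d} = YC.≈.trans (YC.≈.sym (F.Fm-∘ _ _)) (YC.≈.trans (ker-≈ K-unpair∘pair) F.Fm-id)
    where
    K-unpair∘pair : K.Fm (unpair X.∘ pair) Z.≈ K.Fm X.id
    K-unpair∘pair = begin
      K.Fm (unpair X.∘ pair)                        ≈⟨ K.Fm-∘ _ _ ⟩
      K.Fm unpair ∘ K.Fm pair                       ≈⟨ Z.∘-cong (K-lift _) K-pair ⟩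
      (θ⁻¹ m ∘ (Φ ∘ K.aF)) ∘ (K.aF⁻¹ ∘ (Φ⁻¹ ∘ θ m)) ≈⟨ ∘-congʳ (sym-assoc _ _ _) ⟩
      ((θ⁻¹ m ∘ Φ) ∘ K.aF) ∘ (K.aF⁻¹ ∘ (Φ⁻¹ ∘ θ m)) ≈⟨ cancelInner _ _ K.aF-invʳ ⟩
      (θ⁻¹ m ∘ Φ) ∘ (Φ⁻¹ ∘ θ m)                     ≈⟨ cancelInner _ _ (⊗ₘ-inverse (θ∘θ⁻¹ b) (θ∘θ⁻¹ d)) ⟩
      θ⁻¹ m ∘ θ m                                   ≈⟨ θ⁻¹∘θ _ ⟩
      Z.id                                          ≈⟨ K.Fm-id ⟨
      K.Fm X.id                                     ∎
      where
      open ZC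
      open HomReasoning
      open FAObj Z using (_∘_)
      m = b Z.⊗ₒ d

  F-pair∘unpair : ∀ {b d} → F.Fm (pair {b} {d}) Y.∘ F.Fm unpair Y.≈ Y.id
  F-pair∘unpair {b} {d} = YC.≈.trans (YC.≈.sym (F.Fm-∘ _ _)) (YC.≈.trans (ker-≈ K-pair∘unpair) F.Fm-id)
    where
    K-pair∘unpair : K.Fm (pair X.∘ unpair) Z.≈ K.Fm X.id
    K-pair∘unpair = begin
      K.Fm (pair X.∘ unpair)                        ≈⟨ K.Fm-∘ _ _ ⟩
      K.Fm pair ∘ K.Fm unpair                       ≈⟨ Z.∘-cong K-pair (K-lift _) ⟩
      (K.aF⁻¹ ∘ (Φ⁻¹ ∘ θ m)) ∘ (θ⁻¹ m ∘ (Φ ∘ K.aF)) ≈⟨ ∘-congʳ (sym-assoc _ _ _) ⟩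
      ((K.aF⁻¹ ∘ Φ⁻¹) ∘ θ m) ∘ (θ⁻¹ m ∘ (Φ ∘ K.aF)) ≈⟨ cancelInner _ _ (θ∘θ⁻¹ _) ⟩
      (K.aF⁻¹ ∘ Φ⁻¹) ∘ (Φ ∘ K.aF)                   ≈⟨ cancelInner _ _ (⊗ₘ-inverse (θ⁻¹∘θ b) (θ⁻¹∘θ d)) ⟩
      K.aF⁻¹ ∘ K.aF                                 ≈⟨ K.aF-invˡ ⟩
      Z.id                                          ≈⟨ K.Fm-id ⟨
      K.Fm X.id                                     ∎
      where
      open ZC
      open HomReasoning
      open FAObj Z using (_∘_)
      m = b Z.⊗ₒ d

  H-aF⁻¹ : ∀ {b d} → Y.Hom (HFo b Y.⊗ₒ HFo d) (HFo (b Z.⊗ₒ d))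
  H-aF⁻¹ {b} {d} = F.Fm (unpair {b} {d}) Y.∘ F.aF⁻¹

  H-aF-invˡ : ∀ {b d} → H-aF⁻¹ {b} {d} Y.∘ Y.⟨ HFm Z.π₁ , HFm Z.π₂ ⟩ Y.≈ Y.id
  H-aF-invˡ = begin
    (F.Fm unpair ∘ F.aF⁻¹) ∘ ⟨ F.Fm liftHom-π₁ , F.Fm liftHom-π₂ ⟩ ≈⟨ ∘-congˡ (FP.aF∘Fm⟨⟩ _ _) ⟨
    (F.Fm unpair ∘ F.aF⁻¹) ∘ (F.aF ∘ F.Fm pair)                    ≈⟨ cancelInner _ _ F.aF-invˡ ⟩
    F.Fm unpair ∘ F.Fm pair                                        ≈⟨ F-unpair∘pair ⟩
    Y.id                                                           ∎
    where
    open YC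
    open HomReasoning
    open FAObj Y using (_∘_; ⟨_,_⟩)

  H-aF-invʳ : ∀ {b d} → Y.⟨ HFm Z.π₁ , HFm Z.π₂ ⟩ Y.∘ H-aF⁻¹ {b} {d} Y.≈ Y.id
  H-aF-invʳ = begin
    ⟨ F.Fm liftHom-π₁ , F.Fm liftHom-π₂ ⟩ ∘ (F.Fm unpair ∘ F.aF⁻¹) ≈⟨ ∘-congʳ (FP.aF∘Fm⟨⟩ _ _) ⟨
    (F.aF ∘ F.Fm pair) ∘ (F.Fm unpair ∘ F.aF⁻¹)                    ≈⟨ cancelInner _ _ F-pair∘unpair ⟩
    F.aF ∘ F.aF⁻¹                                                  ≈⟨ F.aF-invʳ ⟩
    Y.id                                                           ∎
    where
    open YC
    open HomReasoning
    open FAObj Y using (_∘_; ⟨_,_⟩)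

  HFp : ∀ {d} → Z.P d → Y.P (HFo d)
  HFp {d} r = F.Fp (liftᴾ (Z.Pmap (θ d) r))

  HFp-mono : ∀ {d} {r s : Z.P d} → r Z.≤ᴾ s → HFp r Y.≤ᴾ HFp s
  HFp-mono {d} r≤s =
    ker-≤ᴾ (ZP.≤ᴾ-resp-≈ᴾ (ZP.≈ᴾ.sym (K-liftᴾ _)) (ZP.≈ᴾ.sym (K-liftᴾ _)) (Z.Pmap-mono (θ d) r≤s))

  HFp-nat : ∀ {a b} (g : Z.Hom a b) (r : Z.P b) → HFp (Z.Pmap g r) Y.≈ᴾ Y.Pmap (HFm g) (HFp r)
  HFp-nat {a} {b} g r = YP.≈ᴾ.trans (ker-≈ᴾ K-HFp-nat) (F.Fp-nat (liftHom g) _)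
    where
    open ZP.PReasoning
    K-HFp-nat : K.Fp (liftᴾ (Z.Pmap (θ a) (Z.Pmap g r))) Z.≈ᴾ K.Fp (X.Pmap (liftHom g) (liftᴾ (Z.Pmap (θ b) r)))
    K-HFp-nat = begin
      K.Fp (liftᴾ (Z.Pmap (θ a) (Z.Pmap g r)))                  ≈⟨ K-liftᴾ _ ⟩
      Z.Pmap (θ a) (Z.Pmap g r)                                 ≈⟨ Z.Pmap-∘ _ _ _ ⟨
      Z.Pmap (g Z.∘ θ a) r                                      ≈⟨ Z.Pmap-cong (θ∘K-liftHom g) r ⟨
      Z.Pmap (θ b Z.∘ K.Fm (liftHom g)) r                       ≈⟨ Z.Pmap-∘ _ _ _ ⟩
      Z.Pmap (K.Fm (liftHom g)) (Z.Pmap (θ b) r)                ≈⟨ ZP.Pmap-resp-≈ᴾ _ (K-liftᴾ _) ⟨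
      Z.Pmap (K.Fm (liftHom g)) (K.Fp (liftᴾ (Z.Pmap (θ b) r))) ≈⟨ K.Fp-nat _ _ ⟨
      K.Fp (X.Pmap (liftHom g) (liftᴾ (Z.Pmap (θ b) r)))        ∎

  HFp-hom : ∀ {n} (σ : Language.Conn 𝕃 n) {d} (rs : Fin n → Z.P d) →
            HFp (Z.op σ rs) Y.≈ᴾ Y.op σ (λ i → HFp (rs i))
  HFp-hom σ {d} rs = YP.≈ᴾ.trans (ker-≈ᴾ K-HFp-hom) (F.Fp-hom σ _)
    where
    open ZP.PReasoning
    K-HFp-hom : K.Fp (liftᴾ (Z.Pmap (θ d) (Z.op σ rs))) Z.≈ᴾ K.Fp (X.op σ (λ i → liftᴾ (Z.Pmap (θ d) (rs i))))
    K-HFp-hom = begin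
      K.Fp (liftᴾ (Z.Pmap (θ d) (Z.op σ rs)))           ≈⟨ K-liftᴾ _ ⟩
      Z.Pmap (θ d) (Z.op σ rs)                          ≈⟨ Z.op-nat σ _ _ ⟩
      Z.op σ (λ i → Z.Pmap (θ d) (rs i))                ≈⟨ Z.op-cong σ (λ i → K-liftᴾ _) ⟨
      Z.op σ (λ i → K.Fp (liftᴾ (Z.Pmap (θ d) (rs i)))) ≈⟨ K.Fp-hom σ _ ⟨
      K.Fp (X.op σ (λ i → liftᴾ (Z.Pmap (θ d) (rs i)))) ∎

  θ∘K-unpair∘aF⁻¹ : ∀ {b d} → (θ (b Z.⊗ₒ d) Z.∘ K.Fm unpair) Z.∘ K.aF⁻¹ Z.≈ Φ
  θ∘K-unpair∘aF⁻¹ {b} {d} = begin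
    (θ m ∘ K.Fm unpair) ∘ K.aF⁻¹          ≈⟨ ∘-congʳ (∘-congˡ (K-lift _)) ⟩
    (θ m ∘ (θ⁻¹ m ∘ (Φ ∘ K.aF))) ∘ K.aF⁻¹ ≈⟨ ∘-congʳ (cancelˡ _ (θ∘θ⁻¹ m)) ⟩
    (Φ ∘ K.aF) ∘ K.aF⁻¹                   ≈⟨ cancelʳ _ K.aF-invʳ ⟩
    Φ                                     ∎
    where
    open ZC
    open HomReasoning
    open FAObj Z using (_∘_)
    m = b Z.⊗ₒ d

  Pmap-θ-Ω : ∀ q b d (r : Z.P (b Z.⊗ₒ d)) → Z.Pmap (θ b) (Z.Ω q b d r) Z.≈ᴾ Z.Ω q _ _ (Z.Pmap Φ r)
  Pmap-θ-Ω q b d r = begin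
    Z.Pmap (θ b) (Z.Ω q b d r)                                    ≈⟨ Z.Ω-nat q d (θ b) r ⟨
    Z.Ω q _ d (Z.Pmap (θ b Z.⊗ₘ Z.id) r)                          ≈⟨ ZP.Ω-Pmap-id⊗ₘ≡⇒Hom q _ (K-ob d) _ ⟨
    Z.Ω q _ _ (Z.Pmap (Z.id Z.⊗ₘ θ d) (Z.Pmap (θ b Z.⊗ₘ Z.id) r)) ≈⟨ Z.Ω-cong q _ _ (Z.Pmap-∘ _ _ _) ⟨
    Z.Ω q _ _ (Z.Pmap ((θ b Z.⊗ₘ Z.id) Z.∘ (Z.id Z.⊗ₘ θ d)) r)    ≈⟨ Z.Ω-cong q _ _ (Z.Pmap-cong Φ-split r) ⟩
    Z.Ω q _ _ (Z.Pmap Φ r)                                        ∎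
    where
    open ZP.PReasoning
    Φ-split : (θ b Z.⊗ₘ Z.id) Z.∘ (Z.id Z.⊗ₘ θ d) Z.≈ Φ
    Φ-split = ZC.≈.trans (ZC.⊗ₘ∘⊗ₘ _ _ _ _) (ZC.⊗ₘ-cong (Z.identityʳ _) (Z.identityˡ _))

  Pmap-Φ : ∀ {b d} (r : Z.P (b Z.⊗ₒ d)) →
           Z.Pmap Φ r Z.≈ᴾ Z.Pmap K.aF⁻¹ (K.Fp (X.Pmap unpair (liftᴾ (Z.Pmap (θ (b Z.⊗ₒ d)) r))))
  Pmap-Φ {b} {d} r = begin
    Z.Pmap Φ r                                                           ≈⟨ Z.Pmap-cong θ∘K-unpair∘aF⁻¹ r ⟨
    Z.Pmap ((θ m Z.∘ K.Fm unpair) Z.∘ K.aF⁻¹) r                          ≈⟨ Z.Pmap-∘ _ _ _ ⟩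
    Z.Pmap K.aF⁻¹ (Z.Pmap (θ m Z.∘ K.Fm unpair) r)                       ≈⟨ ZP.Pmap-resp-≈ᴾ _ (Z.Pmap-∘ _ _ _) ⟩
    Z.Pmap K.aF⁻¹ (Z.Pmap (K.Fm unpair) (Z.Pmap (θ m) r))                ≈⟨ ZP.Pmap-resp-≈ᴾ _ (ZP.Pmap-resp-≈ᴾ _ (K-liftᴾ _)) ⟨
    Z.Pmap K.aF⁻¹ (Z.Pmap (K.Fm unpair) (K.Fp (liftᴾ (Z.Pmap (θ m) r)))) ≈⟨ ZP.Pmap-resp-≈ᴾ _ (K.Fp-nat _ _) ⟨
    Z.Pmap K.aF⁻¹ (K.Fp (X.Pmap unpair (liftᴾ (Z.Pmap (θ m) r))))        ∎
    where
    open ZP.PReasoning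
    m = b Z.⊗ₒ d

  HFp-Ω : ∀ q b d (r : Z.P (b Z.⊗ₒ d)) →
          HFp (Z.Ω q b d r) Y.≈ᴾ Y.Ω q (HFo b) (HFo d) (Y.Pmap H-aF⁻¹ (HFp r))
  HFp-Ω q b d r = YP.≈ᴾ.trans (ker-≈ᴾ K-HFp-Ω) (YP.≈ᴾ.sym F-rhs)
    where
    s = liftᴾ (Z.Pmap (θ (b Z.⊗ₒ d)) r)
    F-rhs : Y.Ω q (HFo b) (HFo d) (Y.Pmap H-aF⁻¹ (HFp r)) Y.≈ᴾ F.Fp (X.Ω q (ob b) (ob d) (X.Pmap unpair s))
    F-rhs = YP.≈ᴾ.trans (Y.Ω-cong q _ _ (YP.≈ᴾ.trans (Y.Pmap-∘ _ _ _)
              (YP.Pmap-resp-≈ᴾ _ (YP.≈ᴾ.sym (F.Fp-nat _ _))))) (YP.≈ᴾ.sym (F.Fp-Ω q _ _ _))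
    open ZP.PReasoning
    K-HFp-Ω : K.Fp (liftᴾ (Z.Pmap (θ b) (Z.Ω q b d r))) Z.≈ᴾ K.Fp (X.Ω q (ob b) (ob d) (X.Pmap unpair s))
    K-HFp-Ω = begin
      K.Fp (liftᴾ (Z.Pmap (θ b) (Z.Ω q b d r)))          ≈⟨ K-liftᴾ _ ⟩
      Z.Pmap (θ b) (Z.Ω q b d r)                         ≈⟨ Pmap-θ-Ω q b d r ⟩
      Z.Ω q _ _ (Z.Pmap Φ r)                             ≈⟨ Z.Ω-cong q _ _ (Pmap-Φ r) ⟩
      Z.Ω q _ _ (Z.Pmap K.aF⁻¹ (K.Fp (X.Pmap unpair s))) ≈⟨ K.Fp-Ω q _ _ _ ⟨
      K.Fp (X.Ω q (ob b) (ob d) (X.Pmap unpair s))       ∎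

  HFp-Eq : ∀ d → HFp (Z.Eq d) Y.≈ᴾ Y.Pmap Y.⟨ HFm Z.π₁ , HFm Z.π₂ ⟩ (Y.Eq (HFo d))
  HFp-Eq d = YP.≈ᴾ.trans (ker-≈ᴾ K-HFp-Eq) (YP.≈ᴾ.sym F-rhs)
    where
    m = d Z.⊗ₒ d
    F-rhs : Y.Pmap Y.⟨ HFm Z.π₁ , HFm Z.π₂ ⟩ (Y.Eq (HFo d)) Y.≈ᴾ F.Fp (X.Pmap pair (X.Eq (ob d)))
    F-rhs = YP.≈ᴾ.trans (Y.Pmap-cong (YC.≈.sym (FP.aF∘Fm⟨⟩ _ _)) _) (YP.≈ᴾ.trans (Y.Pmap-∘ _ _ _)
            (YP.≈ᴾ.trans (YP.Pmap-resp-≈ᴾ _ (YP.≈ᴾ.sym (F.Fp-Eq _))) (YP.≈ᴾ.sym (F.Fp-nat _ _))))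
    open ZP.PReasoning
    K-HFp-Eq : K.Fp (liftᴾ (Z.Pmap (θ m) (Z.Eq d))) Z.≈ᴾ K.Fp (X.Pmap pair (X.Eq (ob d)))
    K-HFp-Eq = begin
      K.Fp (liftᴾ (Z.Pmap (θ m) (Z.Eq d)))                  ≈⟨ K-liftᴾ _ ⟩
      Z.Pmap (θ m) (Z.Eq d)                                 ≈⟨ ZP.Pmap-resp-≈ᴾ _ (ZP.Eq-≡⇒Hom (K-ob d)) ⟨
      Z.Pmap (θ m) (Z.Pmap Φ⁻¹ (Z.Eq _))                    ≈⟨ Z.Pmap-∘ _ _ _ ⟨
      Z.Pmap (Φ⁻¹ Z.∘ θ m) (Z.Eq _)                         ≈⟨ Z.Pmap-cong (ZC.cancelˡ _ K.aF-invʳ) _ ⟨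
      Z.Pmap (K.aF Z.∘ (K.aF⁻¹ Z.∘ (Φ⁻¹ Z.∘ θ m))) (Z.Eq _) ≈⟨ Z.Pmap-cong (ZC.∘-congˡ K-pair) _ ⟨
      Z.Pmap (K.aF Z.∘ K.Fm pair) (Z.Eq _)                  ≈⟨ Z.Pmap-∘ _ _ _ ⟩
      Z.Pmap (K.Fm pair) (Z.Pmap K.aF (Z.Eq _))             ≈⟨ ZP.Pmap-resp-≈ᴾ _ (K.Fp-Eq _) ⟨
      Z.Pmap (K.Fm pair) (K.Fp (X.Eq (ob d)))               ≈⟨ K.Fp-nat _ _ ⟨
      K.Fp (X.Pmap pair (X.Eq (ob d)))                      ∎

  H : Mor Z Y
  H = record
    { Fo      = HFo
    ; Fm      = HFm
    ; Fm-cong = HFm-cong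
    ; Fm-id   = HFm-id
    ; Fm-∘    = HFm-∘
    ; 𝟙-inv   = H𝟙-inv
    ; 𝟙-invˡ  = H𝟙-invˡ
    ; 𝟙-invʳ  = YC.!-unique₂ _ _
    ; aF⁻¹    = H-aF⁻¹
    ; aF-invˡ = H-aF-invˡ
    ; aF-invʳ = H-aF-invʳ
    ; Fp      = HFp
    ; Fp-mono = HFp-mono
    ; Fp-nat  = HFp-nat
    ; Fp-hom  = HFp-hom
    ; Fp-Ω    = HFp-Ω
    ; Fp-Eq   = HFp-Eq
    }

  H∘K≡F : CompEq H K F
  H∘K≡F =
    (λ x → proj₁ K≤F _ _ (K-ob (K.Fo x))) ,
    (λ {a} {b} f → ker-HomEq (ZC.≈-conjugate⇒HomEq (K-ob (K.Fo a)) (K-ob (K.Fo b)) (K-liftHom (K.Fm f)))) ,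
    (λ {x} r → ker-PEq (ZP.PEq-trans (refl , K-liftᴾ _) (ZP.Pmap-≡⇒Hom-PEq (K-ob (K.Fo x)) (K.Fp r))))

  H-unique : (H' : Mor Z Y) → CompEq H' K F → MorEq H' H
  H-unique H' (H'K≡F-obj , H'K≡F-hom , H'K≡F-pred) = same-obj , same-hom , same-pred
    where
    module H' = Mor H'
    module H'P = MorProperties H'

    same-obj : ∀ d → H'.Fo d ≡ HFo d
    same-obj d = ≡.trans (≡.cong H'.Fo (≡.sym (K-ob d))) (H'K≡F-obj (ob d))

    same-hom : ∀ {a b} (g : Z.Hom a b) → Y.HomEq (H'.Fm g) (HFm g)
    same-hom {a} {b} g = YC.HomEq-trans (H'P.Fm-conjugate-HomEq (K-ob a) (K-ob b) g)
      (YC.HomEq-trans (refl , refl , H'.Fm-cong (ZC.≈.sym (K-liftHom g))) (H'K≡F-hom (liftHom g)))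

    same-pred : ∀ {d} (r : Z.P d) → Y.PEq (H'.Fp r) (HFp r)
    same-pred {d} r = YP.PEq-trans (YP.PEq-sym (H'P.Fp-PEq (ZP.Pmap-≡⇒Hom-PEq (K-ob d) r)))
      (YP.PEq-trans (refl , H'P.Fp-cong (ZP.≈ᴾ.sym (K-liftᴾ _))) (H'K≡F-pred (liftᴾ (Z.Pmap (θ d) r))))

mainTheorem12 : (𝕃 : Language) (L : Logic 𝕃) (X Y : FALObj L) (F : Mor (obj X) (obj Y)) →
    (Σ (FALObj L) λ I → Σ (Mor (obj X) (obj I)) λ ε → Σ (Mor (obj I) (obj Y)) λ ψ →
       InE ε × InM ψ × CompEq ψ ε F)
    ×
    ((Z : FALObj L) (K : Mor (obj X) (obj Z)) → FullSurj K →
       ((Σ (Mor (obj Z) (obj Y)) λ H → CompEq H K F × ((H' : Mor (obj Z) (obj Y)) → CompEq H' K F → MorEq H' H))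
          → KerLe K F)
       ×
       (KerLe K F
          → Σ (Mor (obj Z) (obj Y)) λ H → CompEq H K F × ((H' : Mor (obj Z) (obj Y)) → CompEq H' K F → MorEq H' H)))
mainTheorem12 𝕃 L X Y F =
  E-M-factorisation L X Y F ,
  λ Z K K-fullSurj →
    (λ (H , H∘K≡F , _) → CompEq⇒KerLe {F = F} {K = K} H H∘K≡F) ,
    (λ K≤F → let open Lifting F K K-fullSurj K≤F in H , H∘K≡F , H-unique)
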